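{- Let $\Bbbk\subseteq\mathbb{R}$ be a subfield. For $f,g\in\Bbbk[V]$ and $h\in\Bbbk[V]\otimes\Lambda(V^*)$, \[df\cdot(dg\odot h)=-dg\odot(df\cdot h)+\tfrac12\big(\nabla^2(fg)-(\nabla^2f)g-f(\nabla^2g)\big)\cdot h.\]
   Context: $V=\Bbbk^n$ with coordinates $x_1,\dots,x_n$; $\Bbbk[V]=\Bbbk[x_1,\dots,x_n]$ and $\Bbbk[V]\otimes\Lambda(V^*)=\Bbbk[x,\theta]$ is generated by commuting $x_i$ and pairwise anticommuting $\theta_i$ commuting with the $x_j$. Exterior derivative: $d(f\theta_I)=\sum_i\frac{\partial f}{\partial x_i}\theta_i\theta_I$, where $\theta_I=\theta_{i_1}\cdots\theta_{i_r}$ for $I=\{i_1<\cdots<i_r\}$. Operators: $\partial_i^x=\partial/\partial x_i$; $m_i^\theta$ = left multiplication by $\theta_i$; $\partial_i^\theta$ is the $\Bbbk[x]$-linear map with $\partial_i^\theta(\theta_{i_1}\cdots\theta_{i_r})=(-1)^{m-1}\theta_{i_1}\cdots\widehat{\theta_{i_m}}\cdots\theta_{i_r}$ if $i=i_m$, and $0$ if $i\notin\{i_1,\dots,i_r\}$. Actions of $\Bbbk[x,\theta]$ on itself: $f\cdot g=f(\partial^x_1,\dots,\partial^x_n,\partial^\theta_1,\dots,\partial^\theta_n)(g)$ and $f\odot g=f(\partial^x_1,\dots,\partial^x_n,m^\theta_1,\dots,m^\theta_n)(g)$. The Laplacian is $\nabla^2=\sum_i(\partial_i^x)^2$. -}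

module Defs where

open import Level using (Level; _⊔_)
open import Algebra.Bundles using (CommutativeRing)
open import Data.Nat using (ℕ; zero; suc)
open import Data.Bool using (Bool; true; false; if_then_else_)
open import Data.Fin using (Fin; zero; suc)
open import Data.Vec using (Vec; []; _∷_; lookup; _[_]≔_; replicate; updateAt)
open import Data.Vec.Properties using (≡-dec)
open import Data.List using (List; []; _∷_; map; concatMap; foldr; _++_)
open import Data.List using () renaming (allFin to allFinL)
open import Data.Product using (_×_; _,_; Σ; ∃)
open import Relation.Nullary using (¬_; yes; no)
import Data.Nat.Properties as ℕP
import Data.Nat as ℕ
import Data.Bool.Properties as BP

-- Hypotheses standing in for "𝕜 ⊆ ℝ is a subfield": 𝕜 is a field of
-- characteristic zero.
module _ {c ℓ : Level} (K : CommutativeRing c ℓ) where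
  open CommutativeRing K using (Carrier; _≈_; _+_; _*_; 0#; 1#)

  fromℕ : ℕ → Carrier
  fromℕ zero    = 0#
  fromℕ (suc m) = 1# + fromℕ m

  record IsCharZeroField : Set (c ⊔ ℓ) where
    field
      nontrivial : ¬ (0# ≈ 1#)
      inverse    : ∀ x → ¬ (x ≈ 0#) → Σ Carrier (λ y → x * y ≈ 1#)
      charZero   : ∀ m → ¬ (fromℕ (suc m) ≈ 0#)

module Super {c ℓ : Level} (K : CommutativeRing c ℓ) (n : ℕ) where
  open CommutativeRing K using (Carrier; _≈_; _+_; _*_; -_; 0#; 1#)

  -- a monomial x^α θ_S : α exponent vector, S the set of θ-indices
  -- (θ_S = θ_{i₁}⋯θ_{i_r} with i₁ < ⋯ < i_r)
  Exp : Set
  Exp = Vec ℕ n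

  Sub : Set
  Sub = Vec Bool n

  -- elements of 𝕜[x,θ] as finite formal sums of c·x^α θ_S
  Poly : Set c
  Poly = List (Carrier × Exp × Sub)

  -- elements of 𝕜[V] = 𝕜[x] as finite formal sums of c·x^α
  PolyX : Set c
  PolyX = List (Carrier × Exp)

  ι : PolyX → Poly
  ι = map (λ { (a , α) → (a , α , replicate n false) })

  coeff : Poly → Exp → Sub → Carrier
  coeff [] α S = 0#
  coeff ((a , β , T) ∷ p) α S with ≡-dec ℕP._≟_ β α | ≡-dec BP._≟_ T S
  ... | yes _ | yes _ = a + coeff p α S
  ... | _     | _     = coeff p α S

  infix 4 _≈P_
  _≈P_ : Poly → Poly → Set ℓ
  p ≈P q = ∀ α S → coeff p α S ≈ coeff q α S

  scale : Carrier → Poly → Poly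
  scale a = map (λ { (b , α , S) → (a * b , α , S) })

  infixl 6 _⊕_ _⊖_
  _⊕_ : Poly → Poly → Poly
  p ⊕ q = p ++ q

  ⊝_ : Poly → Poly
  ⊝ p = scale (- 1#) p

  _⊖_ : Poly → Poly → Poly
  p ⊖ q = p ⊕ (⊝ q)

  ext : (Exp → Sub → Poly) → Poly → Poly
  ext op = concatMap (λ { (a , α , S) → scale a (op α S) })

  negPow : ℕ → Carrier → Carrier
  negPow zero    a = a
  negPow (suc k) a = - negPow k a

  countBefore : ∀ {m} → Fin m → Vec Bool m → ℕ
  countBefore zero    (b ∷ bs) = 0
  countBefore (suc i) (b ∷ bs) = (if b then 1 else 0) ℕ.+ countBefore i bs

  ∂x : Fin n → Poly → Poly
  ∂x i = ext mono
    where
    mono : Exp → Sub → Poly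
    mono α S with lookup α i
    ... | zero  = []
    ... | suc k = (fromℕ K (suc k) , α [ i ]≔ k , S) ∷ []

  mx : Fin n → Poly → Poly
  mx i = ext (λ α S → (1# , updateAt α i suc , S) ∷ [])

  mθ : Fin n → Poly → Poly
  mθ i = ext mono
    where
    mono : Exp → Sub → Poly
    mono α S with lookup S i
    ... | true  = []
    ... | false = (negPow (countBefore i S) 1# , α , S [ i ]≔ true) ∷ []

  -- ∂_i^θ : 𝕜[x]-linear, θ_{i₁}⋯θ_{i_r} ↦ (-1)^{m-1} θ_{i₁}⋯θ̂_{i_m}⋯θ_{i_r}
  ∂θ : Fin n → Poly → Poly
  ∂θ i = ext mono
    where
    mono : Exp → Sub → Poly
    mono α S with lookup S i
    ... | false = []
    ... | true  = (negPow (countBefore i S) 1# , α , S [ i ]≔ false) ∷ []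

  allFin : List (Fin n)
  allFin = allFinL n

  indices : ∀ {m} → Vec Bool m → List (Fin m)
  indices []           = []
  indices (true  ∷ bs) = zero ∷ map suc (indices bs)
  indices (false ∷ bs) = map suc (indices bs)

  iter : ℕ → (Poly → Poly) → Poly → Poly
  iter zero    F p = p
  iter (suc k) F p = F (iter k F p)

  -- substitute operators into the monomial c·x^α θ_{i₁}⋯θ_{i_r}:
  -- c · X₁^{α₁}⋯Xₙ^{αₙ} ∘ T_{i₁} ∘ ⋯ ∘ T_{i_r}
  substMono : (Fin n → Poly → Poly) → (Fin n → Poly → Poly)
            → Carrier → Exp → Sub → Poly → Poly
  substMono X T a α S q =
    scale a (foldr (λ i r → iter (lookup α i) (X i) r) (foldr T q (indices S)) allFin)

  substitute : (Fin n → Poly → Poly) → (Fin n → Poly → Poly) → Poly → Poly → Poly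
  substitute X T f q = concatMap (λ { (a , α , S) → substMono X T a α S q }) f

  infixl 7 _⊛_
  _⊛_ : Poly → Poly → Poly
  f ⊛ g = substitute mx mθ f g

  infixr 7 _·_
  _·_ : Poly → Poly → Poly
  f · g = substitute ∂x ∂θ f g

  infixr 7 _⊙_
  _⊙_ : Poly → Poly → Poly
  f ⊙ g = substitute ∂x mθ f g

  d : Poly → Poly
  d p = concatMap (λ i → mθ i (∂x i p)) allFin

  ∇² : Poly → Poly
  ∇² p = concatMap (λ i → ∂x i (∂x i p)) allFin

-- Under `coeff`, the operators ∂ˣᵢ, m^θᵢ, ∂^θᵢ become explicit
-- operators on coefficient functions, and p · q, p ⊙ q become p(∂ˣ, ∂^θ) and p(∂ˣ, m^θ)
-- applied to the coefficients of q.  Since df = Σᵢ (∂ᵢf) θᵢ, the left-hand side is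
-- Σᵢⱼ (∂ᵢf)(∂ˣ) (∂ⱼg)(∂ˣ) ∂^θᵢ m^θⱼ h and dg ⊙ (df · h) is the same sum with m^θⱼ ∂^θᵢ;
-- by the Clifford relations ∂^θᵢ m^θⱼ + m^θⱼ ∂^θᵢ = δᵢⱼ their sum is Σᵢ (∂ᵢf)(∂ˣ) (∂ᵢg)(∂ˣ) h.
-- On the other side, ∂ᵢP acts as the commutator [P(∂ˣ), xᵢ] (because [∂ˣᵢ, xᵢ] = 1), so
-- expanding ∇²(fg) twice by the Leibniz rule for commutators shows that
-- ½(∇²(fg) − (∇²f)g − f∇²g) acts as Σᵢ [f(∂ˣ), xᵢ][g(∂ˣ), xᵢ] = Σᵢ (∂ᵢf)(∂ˣ) (∂ᵢg)(∂ˣ).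

module Submission where

open import Defs
open import Level using (Level; _⊔_)
open import Algebra.Bundles using (CommutativeRing)
open import Data.Bool using (Bool; true; false; not; if_then_else_)
import Data.Bool.Properties as Boolₚ
open import Data.Fin as Fin using (Fin; zero; suc)
open import Data.List as List using (List; []; _∷_; _++_; foldr; concatMap)
import Data.List.Properties as Listₚ
open import Data.List.Membership.Propositional using (_∈_)
open import Data.List.Membership.Propositional.Properties using (∈-∃++; ∈-allFin)
open import Data.List.Relation.Unary.All as All using (All; []; _∷_)
open import Data.List.Relation.Unary.All.Properties using (++⁻ʳ; ++⁺; concat⁺; map⁺)
open import Data.List.Relation.Unary.AllPairs using (_∷_)
open import Data.List.Relation.Unary.Unique.Propositional using (Unique)
open import Data.List.Relation.Unary.Unique.Propositional.Properties using (allFin⁺)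
open import Data.Nat as ℕ using (ℕ; zero; suc; _<ᵇ_)
import Data.Nat.Properties as ℕₚ
open import Data.Nat.GeneralisedArithmetic using (fold)
open import Data.Nat.Tactic.RingSolver using (solve-∀)
open import Data.Product using (_×_; _,_; ∃₂)
open import Data.Unit using (⊤)
open import Data.Vec using (Vec; _∷_; lookup; replicate; _[_]≔_; updateAt)
open import Data.Vec.Properties as Vecₚ
  using ( []≔-idempotent; []≔-lookup; lookup∘updateAt; lookup∘updateAt′; lookup-replicate
        ; updateAt-commutes; updateAt-cong-local; updateAt-id-local; updateAt-updateAt )
open import Function using (_∘_; const)
open import Relation.Binary using (Setoid)
import Relation.Binary.Reasoning.Setoid as SetoidReasoning
open import Relation.Binary.PropositionalEquality as ≡ using (_≡_; refl; _≢_)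
open import Relation.Nullary using (¬_; yes; no; contradiction)
open import Relation.Nullary.Decidable using (_×-dec_)

module _ {a} {A : Set a} where

  unique-split : ∀ {x : A} xs ys → Unique (xs ++ x ∷ ys) → All (_≢ x) xs × All (_≢ x) ys
  unique-split []       ys (x∉ys ∷ _)  = [] , All.map (_∘ ≡.sym) x∉ys
  unique-split (z ∷ xs) ys (z∉zs ∷ zs!) with xs≢ , ys≢ ← unique-split xs ys zs!
    = All.head (++⁻ʳ xs z∉zs) ∷ xs≢ , ys≢

  ∈-unique-split : ∀ {x : A} {zs} → Unique zs → x ∈ zs →
                   ∃₂ λ xs ys → zs ≡ xs ++ x ∷ ys × All (_≢ x) xs × All (_≢ x) ys
  ∈-unique-split zs! x∈zs with xs , ys , ≡.refl ← ∈-∃++ x∈zs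
    = xs , ys , ≡.refl , unique-split xs ys zs!

allFin-split : ∀ {n} (i : Fin n) →
               ∃₂ λ xs ys → List.allFin n ≡ xs ++ i ∷ ys × All (_≢ i) xs × All (_≢ i) ys
allFin-split {n} i = ∈-unique-split (allFin⁺ n) (∈-allFin i)

module _ {a} {A : Set a} {n : ℕ} where

  lookup-[]≔ : ∀ {xs ys : Vec A n} i {y} → ys ≡ xs [ i ]≔ y → lookup ys i ≡ y
  lookup-[]≔ {xs} i refl = lookup∘updateAt i xs

  []≔-≢ : ∀ {xs ys : Vec A n} i {x y} → lookup xs i ≡ x → x ≢ y → xs ≢ ys [ i ]≔ y
  []≔-≢ i xᵢ≡x x≢y xs≡ = x≢y (≡.trans (≡.sym xᵢ≡x) (lookup-[]≔ i xs≡))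

  []≔-transpose : ∀ {xs ys : Vec A n} i {x y} → lookup xs i ≡ x → xs [ i ]≔ y ≡ ys → xs ≡ ys [ i ]≔ x
  []≔-transpose {xs} i refl refl = ≡.sym (≡.trans ([]≔-idempotent xs i) ([]≔-lookup xs i))

module _ {n : ℕ} where

  updateAt-suc-≢ : ∀ {α β : Vec ℕ n} i → lookup β i ≡ 0 → β ≢ updateAt α i suc
  updateAt-suc-≢ {α} i βᵢ≡0 refl = ℕₚ.0≢1+n (≡.trans (≡.sym βᵢ≡0) (lookup∘updateAt i α))

  []≔-pred⇒updateAt-suc : ∀ {α β : Vec ℕ n} i {k} → lookup β i ≡ suc k →
                          β [ i ]≔ k ≡ α → β ≡ updateAt α i suc
  []≔-pred⇒updateAt-suc {β = β} i βᵢ≡ refl = ≡.trans ([]≔-transpose i βᵢ≡ refl)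
    (updateAt-cong-local i (β [ i ]≔ _) (≡.cong suc (≡.sym (lookup∘updateAt i β))))

  updateAt-suc⇒[]≔-pred : ∀ {α β : Vec ℕ n} i {k} → lookup β i ≡ suc k →
                          β ≡ updateAt α i suc → β [ i ]≔ k ≡ α
  updateAt-suc⇒[]≔-pred {α} i βᵢ≡ refl = ≡.trans (updateAt-updateAt i α)
    (updateAt-id-local i α (ℕₚ.suc-injective (≡.trans (≡.sym βᵢ≡) (lookup∘updateAt i α))))

module LinearOperators {c ℓ : Level} (K : CommutativeRing c ℓ) (A B : Set) where
  open CommutativeRing K hiding (zero) renaming (refl to ≈-refl; sym to ≈-sym; trans to ≈-trans)
  open import Algebra.Properties.Ring ring using (-‿distribʳ-*; -1*x≈-x)
  open import Algebra.Properties.AbelianGroup +-abelianGroup using (⁻¹-∙-comm; xyx⁻¹≈y)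
  open import Algebra.Properties.CommutativeSemigroup +-commutativeSemigroup
    using () renaming (interchange to +-interchange)
  open import Algebra.Properties.CommutativeSemigroup *-commutativeSemigroup
    using () renaming (x∙yz≈y∙xz to *-left-comm)

  Coeffs : Set c
  Coeffs = A → B → Carrier

  infix 4 _≋_
  _≋_ : Coeffs → Coeffs → Set ℓ
  F ≋ G = ∀ α S → F α S ≈ G α S

  ≋-setoid : Setoid c ℓ
  ≋-setoid = record
    { Carrier       = Coeffs
    ; _≈_           = _≋_
    ; isEquivalence = record
      { refl  = λ α S → ≈-refl
      ; sym   = λ F≋G α S → ≈-sym (F≋G α S)
      ; trans = λ F≋G G≋H α S → ≈-trans (F≋G α S) (G≋H α S)
      }
    }

  open Setoid ≋-setoid public using () renaming (refl to ≋-refl; sym to ≋-sym; trans to ≋-trans)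
  module ≋-Reasoning = SetoidReasoning ≋-setoid

  infixl 6 _⊞_
  _⊞_ : Coeffs → Coeffs → Coeffs
  (F ⊞ G) α S = F α S + G α S

  infixr 7 _⋆_
  _⋆_ : Carrier → Coeffs → Coeffs
  (x ⋆ F) α S = x * F α S

  infix 8 ⊟_
  ⊟_ : Coeffs → Coeffs
  (⊟ F) α S = - F α S

  0̂ : Coeffs
  0̂ α S = 0#

  Endo : Set c
  Endo = Coeffs → Coeffs

  record IsLinear (L : Endo) : Set (c ⊔ ℓ) where
    field
      cong   : ∀ {F G} → F ≋ G → L F ≋ L G
      ⊞-homo : ∀ F G → L (F ⊞ G) ≋ L F ⊞ L G
      ⋆-homo : ∀ x F → L (x ⋆ F) ≋ x ⋆ L F

    0̂-homo : L 0̂ ≋ 0̂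
    0̂-homo α S = begin
      L 0̂ α S        ≈⟨ cong (λ _ _ → ≈-sym (zeroˡ 0#)) α S ⟩
      L (0# ⋆ 0̂) α S ≈⟨ ⋆-homo 0# 0̂ α S ⟩
      0# * L 0̂ α S   ≈⟨ zeroˡ _ ⟩
      0#             ∎
      where open SetoidReasoning setoid

    ⊟-homo : ∀ F → L (⊟ F) ≋ ⊟ L F
    ⊟-homo F α S = begin
      L (⊟ F) α S      ≈⟨ cong (λ _ _ → ≈-sym (-1*x≈-x _)) α S ⟩
      L (- 1# ⋆ F) α S ≈⟨ ⋆-homo (- 1#) F α S ⟩
      - 1# * L F α S   ≈⟨ -1*x≈-x _ ⟩
      - L F α S        ∎
      where open SetoidReasoning setoid

  open IsLinear public using (cong; ⊞-homo; ⋆-homo; 0̂-homo; ⊟-homo)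

  id-isLinear : IsLinear (λ F → F)
  id-isLinear = record
    { cong = λ F≋G → F≋G ; ⊞-homo = λ _ _ _ _ → ≈-refl ; ⋆-homo = λ _ _ _ _ → ≈-refl }

  ∘-isLinear : ∀ {L M} → IsLinear L → IsLinear M → IsLinear (L ∘ M)
  ∘-isLinear {L} {M} l m = record
    { cong   = cong l ∘ cong m
    ; ⊞-homo = λ F G → ≋-trans (cong l (⊞-homo m F G)) (⊞-homo l (M F) (M G))
    ; ⋆-homo = λ x F → ≋-trans (cong l (⋆-homo m x F)) (⋆-homo l x (M F))
    }

  fold-isLinear : ∀ {L} k → IsLinear L → IsLinear (λ F → fold F L k)
  fold-isLinear zero    l = id-isLinear
  fold-isLinear (suc k) l = ∘-isLinear l (fold-isLinear k l)

  infixr 7 _⊳_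
  _⊳_ : Bool → Carrier → Carrier
  true  ⊳ x = x
  false ⊳ x = 0#

  ⊳-cong : ∀ b {x y} → x ≈ y → b ⊳ x ≈ b ⊳ y
  ⊳-cong true  x≈y = x≈y
  ⊳-cong false x≈y = ≈-refl

  ⊳-distrib-+ : ∀ b x y → b ⊳ (x + y) ≈ b ⊳ x + b ⊳ y
  ⊳-distrib-+ true  x y = ≈-refl
  ⊳-distrib-+ false x y = ≈-sym (+-identityʳ 0#)

  ⊳-*-comm : ∀ b x y → b ⊳ (x * y) ≈ x * (b ⊳ y)
  ⊳-*-comm true  x y = ≈-refl
  ⊳-*-comm false x y = ≈-sym (zeroʳ x)

  guard-isLinear : (b : A → B → Bool) → IsLinear (λ F α S → b α S ⊳ F α S)
  guard-isLinear b = record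
    { cong   = λ F≋G α S → ⊳-cong (b α S) (F≋G α S)
    ; ⊞-homo = λ F G α S → ⊳-distrib-+ (b α S) _ _
    ; ⋆-homo = λ x F α S → ⊳-*-comm (b α S) x _
    }

  weight-isLinear : (w : A → B → Carrier) → IsLinear (λ F α S → w α S * F α S)
  weight-isLinear w = record
    { cong   = λ F≋G α S → *-congˡ (F≋G α S)
    ; ⊞-homo = λ F G α S → distribˡ _ _ _
    ; ⋆-homo = λ x F α S → *-left-comm _ _ _
    }

  reindex-isLinear : (g : A → B → A) (h : A → B → B) → IsLinear (λ F α S → F (g α S) (h α S))
  reindex-isLinear g h = record
    { cong   = λ F≋G α S → F≋G (g α S) (h α S)
    ; ⊞-homo = λ F G α S → ≈-refl
    ; ⋆-homo = λ x F α S → ≈-refl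
    }

  +-‿-interchange : ∀ x y z w → (x + y) + - (z + w) ≈ (x + - z) + (y + - w)
  +-‿-interchange x y z w = ≈-trans (+-congˡ (≈-sym (⁻¹-∙-comm z w))) (+-interchange _ _ _ _)

  ‿-telescope : ∀ x y z → x + - z ≈ (x + - y) + (y + - z)
  ‿-telescope x y z = ≈-sym (begin
    (x + - y) + (y + - z) ≈⟨ +-assoc _ _ _ ⟩
    x + (- y + (y + - z)) ≈⟨ +-congˡ (+-assoc _ _ _) ⟨
    x + ((- y + y) + - z) ≈⟨ +-congˡ (+-congʳ (-‿inverseˡ y)) ⟩
    x + (0# + - z)        ≈⟨ +-congˡ (+-identityˡ _) ⟩
    x + - z               ∎)
    where open SetoidReasoning setoid

  x+y≈z⇒x≈-y+z : ∀ {x y z} → x + y ≈ z → x ≈ - y + z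
  x+y≈z⇒x≈-y+z {x} {y} {z} x+y≈z = begin
    x             ≈⟨ xyx⁻¹≈y y x ⟨
    y + x + - y   ≈⟨ +-comm _ _ ⟩
    - y + (y + x) ≈⟨ +-congˡ (≈-trans (+-comm y x) x+y≈z) ⟩
    - y + z       ∎
    where open SetoidReasoning setoid

  ⁅_,_⁆ : Endo → Endo → Endo
  ⁅ Φ , M ⁆ X = Φ (M X) ⊞ ⊟ M (Φ X)

  ⁅⁆-isLinear : ∀ {Φ M} → IsLinear Φ → IsLinear M → IsLinear ⁅ Φ , M ⁆
  ⁅⁆-isLinear {Φ} {M} φ m = record
    { cong   = λ F≋G α S → +-cong (cong φ (cong m F≋G) α S) (-‿cong (cong m (cong φ F≋G) α S))
    ; ⊞-homo = λ F G α S → ≈-trans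
        (+-cong (≈-trans (cong φ (⊞-homo m F G) α S) (⊞-homo φ (M F) (M G) α S))
                (-‿cong (≈-trans (cong m (⊞-homo φ F G) α S) (⊞-homo m (Φ F) (Φ G) α S))))
        (+-‿-interchange _ _ _ _)
    ; ⋆-homo = λ x F α S → ≈-trans
        (+-cong (≈-trans (cong φ (⋆-homo m x F) α S) (⋆-homo φ x (M F) α S))
                (≈-trans (-‿cong (≈-trans (cong m (⋆-homo φ x F) α S) (⋆-homo m x (Φ F) α S)))
                         (-‿distribʳ-* _ _)))
        (≈-sym (distribˡ _ _ _))
    }

  ⁅⁆-congˡ : ∀ {Φ Ψ M} → IsLinear M → (∀ X → Φ X ≋ Ψ X) → ∀ X → ⁅ Φ , M ⁆ X ≋ ⁅ Ψ , M ⁆ X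
  ⁅⁆-congˡ m Φ≋Ψ X α S = +-cong (Φ≋Ψ _ α S) (-‿cong (cong m (Φ≋Ψ X) α S))

  ⁅⁆-distribʳ-⊞ : ∀ {M} Φ Ψ → IsLinear M → ∀ X →
                  ⁅ (λ Y → Φ Y ⊞ Ψ Y) , M ⁆ X ≋ ⁅ Φ , M ⁆ X ⊞ ⁅ Ψ , M ⁆ X
  ⁅⁆-distribʳ-⊞ Φ Ψ m X α S =
    ≈-trans (+-congˡ (-‿cong (⊞-homo m (Φ X) (Ψ X) α S))) (+-‿-interchange _ _ _ _)

  ⁅⁆-leibniz : ∀ {Φ M} Ψ → IsLinear Φ → ∀ X →
               ⁅ Φ ∘ Ψ , M ⁆ X ≋ ⁅ Φ , M ⁆ (Ψ X) ⊞ Φ (⁅ Ψ , M ⁆ X)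
  ⁅⁆-leibniz {Φ} {M} Ψ φ X α S = ≈-trans
    (‿-telescope _ (Φ (M (Ψ X)) α S) _)
    (≈-trans (+-comm _ _)
      (+-congˡ (≈-sym (≈-trans (⊞-homo φ _ _ α S) (+-congˡ (⊟-homo φ _ α S))))))

  ⁅⁅⁆⁆-leibniz : ∀ {Φ M} Ψ → IsLinear Φ → IsLinear M → ∀ X →
                 ⁅ ⁅ Φ ∘ Ψ , M ⁆ , M ⁆ X ≋
                   (⁅ ⁅ Φ , M ⁆ , M ⁆ (Ψ X) ⊞ ⁅ Φ , M ⁆ (⁅ Ψ , M ⁆ X))
                   ⊞ (⁅ Φ , M ⁆ (⁅ Ψ , M ⁆ X) ⊞ Φ (⁅ ⁅ Ψ , M ⁆ , M ⁆ X))
  ⁅⁅⁆⁆-leibniz {Φ} {M} Ψ φ m X = begin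
    ⁅ ⁅ Φ ∘ Ψ , M ⁆ , M ⁆ X
      ≈⟨ ⁅⁆-congˡ m (⁅⁆-leibniz {M = M} Ψ φ) X ⟩
    ⁅ (λ Y → ⁅ Φ , M ⁆ (Ψ Y) ⊞ Φ (⁅ Ψ , M ⁆ Y)) , M ⁆ X
      ≈⟨ ⁅⁆-distribʳ-⊞ (⁅ Φ , M ⁆ ∘ Ψ) (Φ ∘ ⁅ Ψ , M ⁆) m X ⟩
    ⁅ ⁅ Φ , M ⁆ ∘ Ψ , M ⁆ X ⊞ ⁅ Φ ∘ ⁅ Ψ , M ⁆ , M ⁆ X
      ≈⟨ (λ α S → +-cong (⁅⁆-leibniz {M = M} Ψ (⁅⁆-isLinear φ m) X α S)
                         (⁅⁆-leibniz {M = M} ⁅ Ψ , M ⁆ φ X α S)) ⟩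
    (⁅ ⁅ Φ , M ⁆ , M ⁆ (Ψ X) ⊞ ⁅ Φ , M ⁆ (⁅ Ψ , M ⁆ X))
      ⊞ (⁅ Φ , M ⁆ (⁅ Ψ , M ⁆ X) ⊞ Φ (⁅ ⁅ Ψ , M ⁆ , M ⁆ X)) ∎
    where open ≋-Reasoning

  ∑ : ∀ {j} {J : Set j} → List J → (J → Coeffs) → Coeffs
  ∑ js G = foldr (λ j → G j ⊞_) 0̂ js

  syntax ∑ js (λ j → G) = ∑[ j ∈ js ] G

  module _ {j} {J : Set j} where

    ∑-cong : ∀ js {G H : J → Coeffs} → (∀ j → G j ≋ H j) → ∑ js G ≋ ∑ js H
    ∑-cong []       G≋H = ≋-refl
    ∑-cong (j ∷ js) G≋H α S = +-cong (G≋H j α S) (∑-cong js G≋H α S)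

    ∑-distrib-⊞ : ∀ js (G H : J → Coeffs) → ∑[ j ∈ js ] (G j ⊞ H j) ≋ ∑ js G ⊞ ∑ js H
    ∑-distrib-⊞ []       G H α S = ≈-sym (+-identityˡ _)
    ∑-distrib-⊞ (j ∷ js) G H α S = ≈-trans (+-congˡ (∑-distrib-⊞ js G H α S)) (+-interchange _ _ _ _)

    ∑-++ : ∀ xs ys (G : J → Coeffs) → ∑ (xs ++ ys) G ≋ ∑ xs G ⊞ ∑ ys G
    ∑-++ []       ys G α S = ≈-sym (+-identityˡ _)
    ∑-++ (x ∷ xs) ys G α S = ≈-trans (+-congˡ (∑-++ xs ys G α S)) (≈-sym (+-assoc _ _ _))

    ∑-concatMap : ∀ {i} {I : Set i} (h : I → List J) is (G : J → Coeffs) →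
                  ∑ (concatMap h is) G ≋ ∑[ i ∈ is ] ∑ (h i) G
    ∑-concatMap h []       G = ≋-refl
    ∑-concatMap h (i ∷ is) G = ≋-trans (∑-++ (h i) (concatMap h is) G) (λ α S → +-congˡ (∑-concatMap h is G α S))

    ∑-isLinear : ∀ js {L : J → Endo} → (∀ j → IsLinear (L j)) → IsLinear (λ F → ∑[ j ∈ js ] L j F)
    ∑-isLinear []       l = record
      { cong = λ _ → ≋-refl ; ⊞-homo = λ _ _ _ _ → ≈-sym (+-identityˡ 0#) ; ⋆-homo = λ x _ _ _ → ≈-sym (zeroʳ x) }
    ∑-isLinear (j ∷ js) {L} l = record
      { cong   = λ F≋G α S → +-cong (cong (l j) F≋G α S) (cong rest F≋G α S)
      ; ⊞-homo = λ F G α S → ≈-trans (+-cong (⊞-homo (l j) F G α S) (⊞-homo rest F G α S)) (+-interchange _ _ _ _)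
      ; ⋆-homo = λ x F α S → ≈-trans (+-cong (⋆-homo (l j) x F α S) (⋆-homo rest x F α S)) (≈-sym (distribˡ _ _ _))
      }
      where
      rest : IsLinear (λ F → ∑[ j ∈ js ] L j F)
      rest = ∑-isLinear js l

    ∑-homo : ∀ {L} → IsLinear L → ∀ js (G : J → Coeffs) → L (∑ js G) ≋ ∑[ j ∈ js ] L (G j)
    ∑-homo l []       G = 0̂-homo l
    ∑-homo l (j ∷ js) G α S = ≈-trans (⊞-homo l (G j) (∑ js G) α S) (+-congˡ (∑-homo l js G α S))

    ∑-vanishes : ∀ {js} {G : J → Coeffs} → All (λ j → G j ≋ 0̂) js → ∑ js G ≋ 0̂
    ∑-vanishes []           = ≋-refl
    ∑-vanishes (G≋0 ∷ G≋0s) α S = ≈-trans (+-cong (G≋0 α S) (∑-vanishes G≋0s α S)) (+-identityˡ _)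

    ∑-comm : ∀ {i} {I : Set i} (is : List I) js (G : I → J → Coeffs) →
             ∑[ i ∈ is ] ∑[ j ∈ js ] G i j ≋ ∑[ j ∈ js ] ∑[ i ∈ is ] G i j
    ∑-comm []       js G = ≋-sym (∑-vanishes (All.universal (λ _ → ≋-refl) js))
    ∑-comm (i ∷ is) js G = ≋-trans (λ α S → +-congˡ (∑-comm is js G α S))
                                   (≋-sym (∑-distrib-⊞ js (G i) (λ j → ∑[ i ∈ is ] G i j)))

    ∑-single : ∀ {js i} {G : J → Coeffs} → Unique js → i ∈ js →
               (∀ j → j ≢ i → G j ≋ 0̂) → ∑ js G ≋ G i
    ∑-single {i = i} {G} js! i∈js G≋0 with xs , ys , ≡.refl , xs≢ , ys≢ ← ∈-unique-split js! i∈js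
      = λ α S → begin
        ∑ (xs ++ i ∷ ys) G α S          ≈⟨ ∑-++ xs (i ∷ ys) G α S ⟩
        ∑ xs G α S + (G i α S + ∑ ys G α S)
          ≈⟨ +-cong (∑-vanishes (All.map (G≋0 _) xs≢) α S) (+-congˡ (∑-vanishes (All.map (G≋0 _) ys≢) α S)) ⟩
        0# + (G i α S + 0#)             ≈⟨ ≈-trans (+-identityˡ _) (+-identityʳ _) ⟩
        G i α S                         ∎
      where open SetoidReasoning setoid


module Semantics {c ℓ : Level} (K : CommutativeRing c ℓ) (n : ℕ) where
  open CommutativeRing K hiding (zero) renaming (refl to ≈-refl; sym to ≈-sym; trans to ≈-trans)
  open Super K n
  open LinearOperators K Exp Sub public
  open SetoidReasoning setoid

  coeff-∷-≡ : ∀ a β T p α S → β ≡ α → T ≡ S → coeff ((a , β , T) ∷ p) α S ≈ a + coeff p α S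
  coeff-∷-≡ a β T p α S β≡α T≡S with Vecₚ.≡-dec ℕₚ._≟_ β α | Vecₚ.≡-dec Boolₚ._≟_ T S
  ... | yes _    | yes _    = ≈-refl
  ... | no  β≢α  | _        = contradiction β≡α β≢α
  ... | yes _    | no  T≢S  = contradiction T≡S T≢S

  coeff-∷-≢ : ∀ a β T p α S → ¬ (β ≡ α × T ≡ S) → coeff ((a , β , T) ∷ p) α S ≈ coeff p α S
  coeff-∷-≢ a β T p α S ≢ with Vecₚ.≡-dec ℕₚ._≟_ β α | Vecₚ.≡-dec Boolₚ._≟_ T S
  ... | yes β≡α | yes T≡S = contradiction (β≡α , T≡S) ≢
  ... | yes _   | no  _   = ≈-refl
  ... | no  _   | _       = ≈-refl

  coeff-[-]-reindex : ∀ w a′ β′ T′ α′ S′ a β T α S →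
                    (β′ ≡ α′ × T′ ≡ S′ → β ≡ α × T ≡ S) → (β ≡ α × T ≡ S → β′ ≡ α′ × T′ ≡ S′) →
                    (β′ ≡ α′ × T′ ≡ S′ → a′ ≈ w * a) →
                    coeff ((a′ , β′ , T′) ∷ []) α′ S′ ≈ w * coeff ((a , β , T) ∷ []) α S
  coeff-[-]-reindex w a′ β′ T′ α′ S′ a β T α S to from scalar
    with Vecₚ.≡-dec ℕₚ._≟_ β′ α′ ×-dec Vecₚ.≡-dec Boolₚ._≟_ T′ S′
  ... | yes (β′≡ , T′≡) = let β≡ , T≡ = to (β′≡ , T′≡) in begin
    coeff ((a′ , β′ , T′) ∷ []) α′ S′ ≈⟨ coeff-∷-≡ a′ β′ T′ [] α′ S′ β′≡ T′≡ ⟩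
    a′ + 0#                         ≈⟨ +-identityʳ a′ ⟩
    a′                              ≈⟨ scalar (β′≡ , T′≡) ⟩
    w * a                           ≈⟨ *-congˡ (+-identityʳ a) ⟨
    w * (a + 0#)                    ≈⟨ *-congˡ (coeff-∷-≡ a β T [] α S β≡ T≡) ⟨
    w * coeff ((a , β , T) ∷ []) α S ∎
  ... | no  ≢′ = ≈-trans (coeff-∷-≢ a′ β′ T′ [] α′ S′ ≢′)
                   (≈-sym (≈-trans (*-congˡ (coeff-∷-≢ a β T [] α S (≢′ ∘ from))) (zeroʳ w)))

  coeff-++ : ∀ p q → coeff (p ++ q) ≋ coeff p ⊞ coeff q
  coeff-++ [] q α S = ≈-sym (+-identityˡ _)
  coeff-++ ((a , β , T) ∷ p) q α S with Vecₚ.≡-dec ℕₚ._≟_ β α | Vecₚ.≡-dec Boolₚ._≟_ T S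
  ... | yes _ | yes _ = ≈-trans (+-congˡ (coeff-++ p q α S)) (≈-sym (+-assoc _ _ _))
  ... | yes _ | no  _ = coeff-++ p q α S
  ... | no  _ | _     = coeff-++ p q α S

  coeff-scale : ∀ x p → coeff (scale x p) ≋ x ⋆ coeff p
  coeff-scale x [] α S = ≈-sym (zeroʳ x)
  coeff-scale x ((b , β , T) ∷ p) α S with Vecₚ.≡-dec ℕₚ._≟_ β α | Vecₚ.≡-dec Boolₚ._≟_ T S
  ... | yes _ | yes _ = ≈-trans (+-congˡ (coeff-scale x p α S)) (≈-sym (distribˡ _ _ _))
  ... | yes _ | no  _ = coeff-scale x p α S
  ... | no  _ | _     = coeff-scale x p α S

  coeff-⊝⊕ : ∀ p q → coeff (⊝ p ⊕ q) ≋ ⊟ coeff p ⊞ coeff q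
  coeff-⊝⊕ p q α S = ≈-trans (coeff-++ (⊝ p) q α S) (+-congʳ (≈-trans (coeff-scale (- 1#) p α S) (-1*x≈-x _)))
    where open import Algebra.Properties.Ring ring using (-1*x≈-x)

  ext-∷ : ∀ op m p → ext op (m ∷ p) ≡ ext op (m ∷ []) ++ ext op p
  ext-∷ op (a , β , T) p = ≡.cong (_++ ext op p) (≡.sym (Listₚ.++-identityʳ (scale a (op β T))))

  coeff-ext : ∀ op {L} → IsLinear L →
              (∀ a β T → coeff (ext op ((a , β , T) ∷ [])) ≋ L (coeff ((a , β , T) ∷ []))) →
              ∀ p → coeff (ext op p) ≋ L (coeff p)
  coeff-ext op l ext≋L [] = ≋-sym (0̂-homo l)
  coeff-ext op {L} l ext≋L (m@(a , β , T) ∷ p) α S = begin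
    coeff (ext op (m ∷ p)) α S
      ≡⟨ ≡.cong (λ q → coeff q α S) (ext-∷ op m p) ⟩
    coeff (ext op [ m ] ++ ext op p) α S
      ≈⟨ coeff-++ (ext op [ m ]) (ext op p) α S ⟩
    coeff (ext op [ m ]) α S + coeff (ext op p) α S
      ≈⟨ +-cong (ext≋L a β T α S) (coeff-ext op l ext≋L p α S) ⟩
    L (coeff [ m ]) α S + L (coeff p) α S
      ≈⟨ ⊞-homo l (coeff [ m ]) (coeff p) α S ⟨
    L (coeff [ m ] ⊞ coeff p) α S
      ≈⟨ cong l (coeff-++ [ m ] p) α S ⟨
    L (coeff (m ∷ p)) α S ∎
    where
    [_] : Carrier × Exp × Sub → Poly
    [ m ] = m ∷ []

  sgn : Fin n → Sub → Carrier
  sgn i S = negPow (countBefore i S) 1#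

  ∂xᶜ mxᶜ mθᶜ ∂θᶜ : Fin n → Endo
  ∂xᶜ i F α S = fromℕ K (suc (lookup α i)) * F (updateAt α i suc) S
  mxᶜ i F α S = (0 <ᵇ lookup α i) ⊳ F (updateAt α i ℕ.pred) S
  mθᶜ i F α S = lookup S i ⊳ (sgn i S * F α (S [ i ]≔ false))
  ∂θᶜ i F α S = not (lookup S i) ⊳ (sgn i S * F α (S [ i ]≔ true))

  ∂xᶜ-isLinear : ∀ i → IsLinear (∂xᶜ i)
  ∂xᶜ-isLinear i = ∘-isLinear (weight-isLinear λ α _ → fromℕ K (suc (lookup α i)))
                              (reindex-isLinear (λ α _ → updateAt α i suc) (λ _ S → S))

  mxᶜ-isLinear : ∀ i → IsLinear (mxᶜ i)
  mxᶜ-isLinear i = ∘-isLinear (guard-isLinear λ α _ → 0 <ᵇ lookup α i)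
                              (reindex-isLinear (λ α _ → updateAt α i ℕ.pred) (λ _ S → S))

  mθᶜ-isLinear : ∀ i → IsLinear (mθᶜ i)
  mθᶜ-isLinear i = ∘-isLinear (guard-isLinear λ _ S → lookup S i)
    (∘-isLinear (weight-isLinear λ _ S → sgn i S) (reindex-isLinear (λ α _ → α) (λ _ S → S [ i ]≔ false)))

  ∂θᶜ-isLinear : ∀ i → IsLinear (∂θᶜ i)
  ∂θᶜ-isLinear i = ∘-isLinear (guard-isLinear λ _ S → not (lookup S i))
    (∘-isLinear (weight-isLinear λ _ S → sgn i S) (reindex-isLinear (λ α _ → α) (λ _ S → S [ i ]≔ true)))

  countBefore-[]≔ : ∀ {m} (i : Fin m) S b → countBefore i (S [ i ]≔ b) ≡ countBefore i S
  countBefore-[]≔ zero    (_ ∷ S) b = refl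
  countBefore-[]≔ (suc i) (c ∷ S) b = ≡.cong ((if c then 1 else 0) ℕ.+_) (countBefore-[]≔ i S b)

  sgn-[]≔ : ∀ i S b → sgn i (S [ i ]≔ b) ≡ sgn i S
  sgn-[]≔ i S b = ≡.cong (λ k → negPow k 1#) (countBefore-[]≔ i S b)

  ∂x-monomial : ∀ i a β T → coeff (∂x i ((a , β , T) ∷ [])) ≋ ∂xᶜ i (coeff ((a , β , T) ∷ []))
  ∂x-monomial i a β T α S with lookup β i in βᵢ≡
  ... | zero  = ≈-sym (≈-trans (*-congˡ (coeff-∷-≢ a β T [] _ S λ (β≡ , _) → updateAt-suc-≢ i βᵢ≡ β≡)) (zeroʳ _))
  ... | suc k = coeff-[-]-reindex _ _ (β [ i ]≔ k) T α S a β T (updateAt α i suc) S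
    (λ (β′≡ , T≡) → []≔-pred⇒updateAt-suc i βᵢ≡ β′≡ , T≡)
    (λ (β≡ , T≡) → updateAt-suc⇒[]≔-pred i βᵢ≡ β≡ , T≡)
    (λ (β′≡ , _) → ≈-trans (*-comm a _)
      (*-congʳ (reflexive (≡.cong (λ k → fromℕ K (suc k)) (≡.sym (lookup-[]≔ i (≡.sym β′≡)))))))

  mθ-monomial : ∀ i a β T → coeff (mθ i ((a , β , T) ∷ [])) ≋ mθᶜ i (coeff ((a , β , T) ∷ []))
  mθ-monomial i a β T α S with lookup T i in Tᵢ≡ | lookup S i in Sᵢ≡
  ... | true  | false = ≈-refl
  ... | true  | true  = ≈-sym (≈-trans
    (*-congˡ (coeff-∷-≢ a β T [] α _ λ (_ , T≡) → []≔-≢ i Tᵢ≡ (λ ()) T≡)) (zeroʳ _))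
  ... | false | false = coeff-∷-≢ _ β (T [ i ]≔ true) [] α S λ (_ , T′≡) → []≔-≢ i Sᵢ≡ (λ ()) (≡.sym T′≡)
  ... | false | true  = coeff-[-]-reindex _ _ β (T [ i ]≔ true) α S a β T α (S [ i ]≔ false)
    (λ (β≡ , T′≡) → β≡ , []≔-transpose i Tᵢ≡ T′≡)
    (λ (β≡ , T≡) → β≡ , ≡.sym ([]≔-transpose i Sᵢ≡ (≡.sym T≡)))
    (λ (_ , T′≡) → ≈-trans (*-comm a _)
      (*-congʳ (reflexive (≡.trans (≡.sym (sgn-[]≔ i T true)) (≡.cong (sgn i) T′≡)))))

  ∂θ-monomial : ∀ i a β T → coeff (∂θ i ((a , β , T) ∷ [])) ≋ ∂θᶜ i (coeff ((a , β , T) ∷ []))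
  ∂θ-monomial i a β T α S with lookup T i in Tᵢ≡ | lookup S i in Sᵢ≡
  ... | false | true  = ≈-refl
  ... | false | false = ≈-sym (≈-trans
    (*-congˡ (coeff-∷-≢ a β T [] α _ λ (_ , T≡) → []≔-≢ i Tᵢ≡ (λ ()) T≡)) (zeroʳ _))
  ... | true  | true  = coeff-∷-≢ _ β (T [ i ]≔ false) [] α S λ (_ , T′≡) → []≔-≢ i Sᵢ≡ (λ ()) (≡.sym T′≡)
  ... | true  | false = coeff-[-]-reindex _ _ β (T [ i ]≔ false) α S a β T α (S [ i ]≔ true)
    (λ (β≡ , T′≡) → β≡ , []≔-transpose i Tᵢ≡ T′≡)
    (λ (β≡ , T≡) → β≡ , ≡.sym ([]≔-transpose i Sᵢ≡ (≡.sym T≡)))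
    (λ (_ , T′≡) → ≈-trans (*-comm a _)
      (*-congʳ (reflexive (≡.trans (≡.sym (sgn-[]≔ i T false)) (≡.cong (sgn i) T′≡)))))

  coeff-∂x : ∀ i p → coeff (∂x i p) ≋ ∂xᶜ i (coeff p)
  coeff-∂x i = coeff-ext _ (∂xᶜ-isLinear i) (∂x-monomial i)

  coeff-mθ : ∀ i p → coeff (mθ i p) ≋ mθᶜ i (coeff p)
  coeff-mθ i = coeff-ext _ (mθᶜ-isLinear i) (mθ-monomial i)

  coeff-∂θ : ∀ i p → coeff (∂θ i p) ≋ ∂θᶜ i (coeff p)
  coeff-∂θ i = coeff-ext _ (∂θᶜ-isLinear i) (∂θ-monomial i)

module CoefficientOperators {c ℓ : Level} (K : CommutativeRing c ℓ) (n : ℕ) where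
  open CommutativeRing K hiding (zero) renaming (refl to ≈-refl; sym to ≈-sym; trans to ≈-trans)
  open Super K n
  open Semantics K n public
  open SetoidReasoning setoid
  open import Algebra.Properties.Ring ring using (-‿distribˡ-*; -‿distribʳ-*; -‿involutive)
  open import Algebra.Properties.CommutativeSemigroup *-commutativeSemigroup
    using () renaming (x∙yz≈y∙xz to *-left-comm)

  ⊳-comm : ∀ b b′ x → b ⊳ (b′ ⊳ x) ≡ b′ ⊳ (b ⊳ x)
  ⊳-comm true  true  x = refl
  ⊳-comm true  false x = refl
  ⊳-comm false true  x = refl
  ⊳-comm false false x = refl

  ⊳-*-zeroʳ : ∀ b x → b ⊳ (x * 0#) ≈ 0#
  ⊳-*-zeroʳ true  x = zeroʳ x
  ⊳-*-zeroʳ false x = ≈-refl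

  ∂xᶜ-comm : ∀ i j F → ∂xᶜ i (∂xᶜ j F) ≋ ∂xᶜ j (∂xᶜ i F)
  ∂xᶜ-comm i j F α S with i Fin.≟ j
  ... | yes refl = ≈-refl
  ... | no  i≢j  = begin
    fromℕ K (suc (lookup α i)) * (fromℕ K (suc (lookup (updateAt α i suc) j)) * F (updateAt (updateAt α i suc) j suc) S)
      ≡⟨ ≡.cong₂ (λ k β → fromℕ K (suc (lookup α i)) * (fromℕ K (suc k) * F β S))
           (lookup∘updateAt′ j i (i≢j ∘ ≡.sym) α) (updateAt-commutes j i (i≢j ∘ ≡.sym) α) ⟩
    fromℕ K (suc (lookup α i)) * (fromℕ K (suc (lookup α j)) * F (updateAt (updateAt α j suc) i suc) S)
      ≈⟨ *-left-comm _ _ _ ⟩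
    fromℕ K (suc (lookup α j)) * (fromℕ K (suc (lookup α i)) * F (updateAt (updateAt α j suc) i suc) S)
      ≡⟨ ≡.cong (λ k → fromℕ K (suc (lookup α j)) * (fromℕ K (suc k) * F (updateAt (updateAt α j suc) i suc) S))
           (lookup∘updateAt′ i j i≢j α) ⟨
    fromℕ K (suc (lookup α j)) * (fromℕ K (suc (lookup (updateAt α j suc) i)) * F (updateAt (updateAt α j suc) i suc) S) ∎

  ∂xᶜ-mθᶜ-comm : ∀ i j F → ∂xᶜ i (mθᶜ j F) ≋ mθᶜ j (∂xᶜ i F)
  ∂xᶜ-mθᶜ-comm i j F α S = ≈-sym (≈-trans (⊳-cong (lookup S j) (*-left-comm _ _ _)) (⊳-*-comm (lookup S j) _ _))

  ∂xᶜ-∂θᶜ-comm : ∀ i j F → ∂xᶜ i (∂θᶜ j F) ≋ ∂θᶜ j (∂xᶜ i F)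
  ∂xᶜ-∂θᶜ-comm i j F α S = ≈-sym (≈-trans (⊳-cong (not (lookup S j)) (*-left-comm _ _ _)) (⊳-*-comm (not (lookup S j)) _ _))

  mxᶜ-∂θᶜ-comm : ∀ i j F → mxᶜ i (∂θᶜ j F) ≋ ∂θᶜ j (mxᶜ i F)
  mxᶜ-∂θᶜ-comm i j F α S = ≈-trans (reflexive (⊳-comm (0 ℕ.<ᵇ lookup α i) (not (lookup S j)) _))
                                   (⊳-cong (not (lookup S j)) (⊳-*-comm (0 ℕ.<ᵇ lookup α i) _ _))

  ∂xᶜ-mxᶜ-comm : ∀ {i j} → i ≢ j → ∀ F → ∂xᶜ i (mxᶜ j F) ≋ mxᶜ j (∂xᶜ i F)
  ∂xᶜ-mxᶜ-comm {i} {j} i≢j F α S = begin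
    fromℕ K (suc (lookup α i)) * ((0 ℕ.<ᵇ lookup (updateAt α i suc) j) ⊳ F (updateAt (updateAt α i suc) j ℕ.pred) S)
      ≡⟨ ≡.cong₂ (λ k β → fromℕ K (suc (lookup α i)) * ((0 ℕ.<ᵇ k) ⊳ F β S))
           (lookup∘updateAt′ j i j≢i α) (updateAt-commutes j i j≢i α) ⟩
    fromℕ K (suc (lookup α i)) * ((0 ℕ.<ᵇ lookup α j) ⊳ F (updateAt (updateAt α j ℕ.pred) i suc) S)
      ≈⟨ ⊳-*-comm (0 ℕ.<ᵇ lookup α j) _ _ ⟨
    (0 ℕ.<ᵇ lookup α j) ⊳ (fromℕ K (suc (lookup α i)) * F (updateAt (updateAt α j ℕ.pred) i suc) S)
      ≡⟨ ≡.cong (λ k → (0 ℕ.<ᵇ lookup α j) ⊳ (fromℕ K (suc k) * F (updateAt (updateAt α j ℕ.pred) i suc) S))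
           (lookup∘updateAt′ i j i≢j α) ⟨
    (0 ℕ.<ᵇ lookup α j) ⊳ (fromℕ K (suc (lookup (updateAt α j ℕ.pred) i)) * F (updateAt (updateAt α j ℕ.pred) i suc) S) ∎
    where
    j≢i : j ≢ i
    j≢i j≡i = i≢j (≡.sym j≡i)

  ∂xᶜ-mxᶜ-leibniz : ∀ i F → ∂xᶜ i (mxᶜ i F) ≋ F ⊞ mxᶜ i (∂xᶜ i F)
  ∂xᶜ-mxᶜ-leibniz i F α S = begin
    fromℕ K (suc (lookup α i)) * ((0 ℕ.<ᵇ lookup (updateAt α i suc) i) ⊳ F (updateAt (updateAt α i suc) i ℕ.pred) S)
      ≡⟨ ≡.cong₂ (λ k β → fromℕ K (suc (lookup α i)) * ((0 ℕ.<ᵇ k) ⊳ F β S))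
           (lookup∘updateAt i α) (≡.trans (updateAt-updateAt i α) (updateAt-id-local i α refl)) ⟩
    fromℕ K (suc (lookup α i)) * F α S
      ≈⟨ split (lookup α i) refl ⟩
    F α S + (0 ℕ.<ᵇ lookup α i) ⊳ (fromℕ K (suc (lookup α⁻ i)) * F (updateAt α⁻ i suc) S) ∎
    where
    α⁻ : Exp
    α⁻ = updateAt α i ℕ.pred
    split : ∀ k → lookup α i ≡ k →
            fromℕ K (suc k) * F α S ≈ F α S + (0 ℕ.<ᵇ k) ⊳ (fromℕ K (suc (lookup α⁻ i)) * F (updateAt α⁻ i suc) S)
    split zero    _   = ≈-trans (distribʳ _ _ _) (+-cong (*-identityˡ _) (zeroˡ _))
    split (suc k) αᵢ≡ = ≈-trans (≈-trans (distribʳ _ _ _) (+-congʳ (*-identityˡ _)))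
      (+-congˡ (reflexive (≡.cong₂ (λ k β → fromℕ K (suc k) * F β S)
        (≡.sym (≡.trans (lookup∘updateAt i α) (≡.cong ℕ.pred αᵢ≡)))
        (≡.sym (≡.trans (updateAt-updateAt i α)
          (updateAt-id-local i α (≡.trans (≡.cong (λ m → suc (ℕ.pred m)) αᵢ≡) (≡.sym αᵢ≡))))))))

  negPow-+ : ∀ a b → negPow a 1# * negPow b 1# ≈ negPow (a ℕ.+ b) 1#
  negPow-+ zero    b = *-identityˡ _
  negPow-+ (suc a) b = ≈-trans (≈-sym (-‿distribˡ-* _ _)) (-‿cong (negPow-+ a b))

  negPow-square : ∀ a → negPow a 1# * negPow a 1# ≈ 1#
  negPow-square zero    = *-identityˡ _
  negPow-square (suc a) = ≈-trans (≈-sym (-‿distribˡ-* _ _))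
    (≈-trans (-‿cong (≈-sym (-‿distribʳ-* _ _))) (≈-trans (-‿involutive _) (negPow-square a)))

  negPow-cancel : ∀ a b a′ b′ x → a ℕ.+ b ≡ suc (a′ ℕ.+ b′) →
                  negPow a 1# * (negPow b 1# * x) + negPow a′ 1# * (negPow b′ 1# * x) ≈ 0#
  negPow-cancel a b a′ b′ x a+b≡ = begin
    negPow a 1# * (negPow b 1# * x) + negPow a′ 1# * (negPow b′ 1# * x)
      ≈⟨ +-cong (≈-trans (≈-sym (*-assoc _ _ _)) (*-congʳ (negPow-+ a b)))
                (≈-trans (≈-sym (*-assoc _ _ _)) (*-congʳ (negPow-+ a′ b′))) ⟩
    negPow (a ℕ.+ b) 1# * x + negPow (a′ ℕ.+ b′) 1# * x
      ≡⟨ ≡.cong (λ k → negPow k 1# * x + negPow (a′ ℕ.+ b′) 1# * x) a+b≡ ⟩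
    - negPow (a′ ℕ.+ b′) 1# * x + negPow (a′ ℕ.+ b′) 1# * x ≈⟨ distribʳ _ _ _ ⟨
    (- negPow (a′ ℕ.+ b′) 1# + negPow (a′ ℕ.+ b′) 1#) * x    ≈⟨ *-congʳ (-‿inverseˡ _) ⟩
    0# * x                                                   ≈⟨ zeroˡ _ ⟩
    0#                                                       ∎

  countBefore-anticomm : ∀ {m} (i j : Fin m) (S : Vec Bool m) → i ≢ j → lookup S i ≡ false → lookup S j ≡ true →
    countBefore i S ℕ.+ countBefore j (S [ i ]≔ true) ≡ suc (countBefore j S ℕ.+ countBefore i (S [ j ]≔ false))
  countBefore-anticomm zero    zero    S           i≢j _ _ = contradiction refl i≢j
  countBefore-anticomm zero    (suc j) (false ∷ S) _   _ _ = ≡.cong suc (≡.sym (ℕₚ.+-identityʳ _))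
  countBefore-anticomm (suc i) zero    (true ∷ S)  _   _ _ = ℕₚ.+-identityʳ _
  countBefore-anticomm (suc i) (suc j) (b ∷ S) i≢j Sᵢ≡ Sⱼ≡ =
    shift (if b then 1 else 0) (countBefore-anticomm i j S (λ i≡j → i≢j (≡.cong suc i≡j)) Sᵢ≡ Sⱼ≡)
    where
    shift : ∀ x {a b a′ b′} → a ℕ.+ b ≡ suc (a′ ℕ.+ b′) → x ℕ.+ a ℕ.+ (x ℕ.+ b) ≡ suc (x ℕ.+ a′ ℕ.+ (x ℕ.+ b′))
    shift x {a} {b} {a′} {b′} e = ≡.trans (lhs x a b) (≡.trans (≡.cong ((x ℕ.+ x) ℕ.+_) e) (≡.sym (rhs x a′ b′)))
      where
      lhs : ∀ x a b → x ℕ.+ a ℕ.+ (x ℕ.+ b) ≡ (x ℕ.+ x) ℕ.+ (a ℕ.+ b)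
      lhs = solve-∀
      rhs : ∀ x a b → suc (x ℕ.+ a ℕ.+ (x ℕ.+ b)) ≡ (x ℕ.+ x) ℕ.+ suc (a ℕ.+ b)
      rhs = solve-∀

  ∂θᶜ-mθᶜ-anticomm : ∀ {i j} → i ≢ j → ∀ F → ∂θᶜ i (mθᶜ j F) ⊞ mθᶜ j (∂θᶜ i F) ≋ 0̂
  ∂θᶜ-mθᶜ-anticomm {i} {j} i≢j F α S
    rewrite lookup∘updateAt′ j i {const true} (λ j≡i → i≢j (≡.sym j≡i)) S
          | lookup∘updateAt′ i j {const false} i≢j S
          | updateAt-commutes j i {const false} {const true} (λ j≡i → i≢j (≡.sym j≡i)) S
    with lookup S i in Sᵢ≡ | lookup S j in Sⱼ≡
  ... | true  | b     = ≈-trans (+-identityˡ _) (⊳-*-zeroʳ b (sgn j S))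
  ... | false | false = ≈-trans (+-identityʳ _) (zeroʳ (sgn i S))
  ... | false | true  = negPow-cancel (countBefore i S) (countBefore j (S [ i ]≔ true))
                          (countBefore j S) (countBefore i (S [ j ]≔ false)) _
                          (countBefore-anticomm i j S i≢j Sᵢ≡ Sⱼ≡)

  sgn-involutive : ∀ i S {b} (F : Coeffs) α → lookup S i ≡ b → sgn i S * (sgn i S * F α (S [ i ]≔ b)) ≈ F α S
  sgn-involutive i S {b} F α Sᵢ≡ = begin
    sgn i S * (sgn i S * F α (S [ i ]≔ b)) ≈⟨ *-assoc _ _ _ ⟨
    (sgn i S * sgn i S) * F α (S [ i ]≔ b) ≈⟨ *-congʳ (negPow-square (countBefore i S)) ⟩
    1# * F α (S [ i ]≔ b)                  ≈⟨ *-identityˡ _ ⟩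
    F α (S [ i ]≔ b)                       ≡⟨ ≡.cong (F α) (updateAt-id-local i S (≡.sym Sᵢ≡)) ⟩
    F α S                                  ∎

  ∂θᶜ-mθᶜ-anticomm-self : ∀ i F → ∂θᶜ i (mθᶜ i F) ⊞ mθᶜ i (∂θᶜ i F) ≋ F
  ∂θᶜ-mθᶜ-anticomm-self i F α S
    rewrite lookup∘updateAt i {const true} S
          | lookup∘updateAt i {const false} S
          | countBefore-[]≔ i S true | countBefore-[]≔ i S false
          | updateAt-updateAt i {const false} {const true} S
          | updateAt-updateAt i {const true} {const false} S
    with lookup S i in Sᵢ≡
  ... | false = ≈-trans (+-identityʳ _) (sgn-involutive i S F α Sᵢ≡)
  ... | true  = ≈-trans (+-identityˡ _) (sgn-involutive i S F α Sᵢ≡)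

module PartialDerivatives {c ℓ : Level} (K : CommutativeRing c ℓ) (n : ℕ) where
  open CommutativeRing K hiding (zero) renaming (refl to ≈-refl; sym to ≈-sym; trans to ≈-trans)
  open Super K n
  open CoefficientOperators K n public

  ∂ᶜ^-over : List (Fin n) → Exp → Endo
  ∂ᶜ^-over is α G = foldr (λ i r → fold r (∂xᶜ i) (lookup α i)) G is

  ∂ᶜ^ : Exp → Endo
  ∂ᶜ^ = ∂ᶜ^-over allFin

  ∂ᶜ^-over-isLinear : ∀ is α → IsLinear (∂ᶜ^-over is α)
  ∂ᶜ^-over-isLinear []       α = id-isLinear
  ∂ᶜ^-over-isLinear (i ∷ is) α = ∘-isLinear (fold-isLinear (lookup α i) (∂xᶜ-isLinear i)) (∂ᶜ^-over-isLinear is α)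

  coeff-iter-∂x : ∀ i k r → coeff (iter k (∂x i) r) ≋ fold (coeff r) (∂xᶜ i) k
  coeff-iter-∂x i zero    r = ≋-refl
  coeff-iter-∂x i (suc k) r = ≋-trans (coeff-∂x i (iter k (∂x i) r)) (cong (∂xᶜ-isLinear i) (coeff-iter-∂x i k r))

  coeff-∂x-pow : ∀ is α q → coeff (foldr (λ i r → iter (lookup α i) (∂x i) r) q is) ≋ ∂ᶜ^-over is α (coeff q)
  coeff-∂x-pow []       α q = ≋-refl
  coeff-∂x-pow (i ∷ is) α q = ≋-trans (coeff-iter-∂x i (lookup α i) (foldr (λ i r → iter (lookup α i) (∂x i) r) q is))
    (cong (fold-isLinear (lookup α i) (∂xᶜ-isLinear i)) (coeff-∂x-pow is α q))

  fold-comm : ∀ {L M} → IsLinear L → IsLinear M → (∀ G → L (M G) ≋ M (L G)) →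
              ∀ k G → fold (M G) L k ≋ M (fold G L k)
  fold-comm l m LM≋ML zero    G = ≋-refl
  fold-comm l m LM≋ML (suc k) G = ≋-trans (cong l (fold-comm l m LM≋ML k G)) (LM≋ML _)

  ∂ᶜ^-over-comm : ∀ {Q : Fin n → Set} {M} → IsLinear M → (∀ {j} → Q j → ∀ G → ∂xᶜ j (M G) ≋ M (∂xᶜ j G)) →
                  ∀ α {is} → All Q is → ∀ G → ∂ᶜ^-over is α (M G) ≋ M (∂ᶜ^-over is α G)
  ∂ᶜ^-over-comm m comm α []                   G = ≋-refl
  ∂ᶜ^-over-comm m comm α {i ∷ is} (qᵢ ∷ qs) G =
    ≋-trans (cong (fold-isLinear (lookup α i) (∂xᶜ-isLinear i)) (∂ᶜ^-over-comm m comm α qs G))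
            (fold-comm (∂xᶜ-isLinear i) m (comm qᵢ) (lookup α i) _)

  ∂ᶜ^-comm : ∀ {M} → IsLinear M → (∀ j G → ∂xᶜ j (M G) ≋ M (∂xᶜ j G)) → ∀ α G → ∂ᶜ^ α (M G) ≋ M (∂ᶜ^ α G)
  ∂ᶜ^-comm m comm α = ∂ᶜ^-over-comm {Q = λ _ → ⊤} m (λ {j} _ → comm j) α (All.universal _ allFin)

  ∂ᶜ^-over-updateAt : ∀ α i f {is} → All (_≢ i) is → ∀ G → ∂ᶜ^-over is (updateAt α i f) G ≡ ∂ᶜ^-over is α G
  ∂ᶜ^-over-updateAt α i f []                  G = refl
  ∂ᶜ^-over-updateAt α i f {j ∷ is} (j≢i ∷ js≢i) G =
    ≡.cong₂ (λ k r → fold r (∂xᶜ j) k) (lookup∘updateAt′ j i j≢i α) (∂ᶜ^-over-updateAt α i f js≢i G)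

  ∂ᶜ^-split : ∀ α i {xs ys} → allFin ≡ xs ++ i ∷ ys → ∀ G →
              ∂ᶜ^ α G ≡ ∂ᶜ^-over xs α (fold (∂ᶜ^-over ys α G) (∂xᶜ i) (lookup α i))
  ∂ᶜ^-split α i {xs} {ys} allFin≡ G =
    ≡.trans (≡.cong (λ is → ∂ᶜ^-over is α G) allFin≡) (Listₚ.foldr-++ _ G xs (i ∷ ys))

  ∂ᶜ^-updateAt-suc : ∀ α i G → ∂ᶜ^ (updateAt α i suc) G ≋ ∂xᶜ i (∂ᶜ^ α G)
  ∂ᶜ^-updateAt-suc α i G with xs , ys , allFin≡ , xs≢i , ys≢i ← allFin-split i = begin
      ∂ᶜ^ α⁺ G
        ≡⟨ ∂ᶜ^-split α⁺ i allFin≡ G ⟩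
      ∂ᶜ^-over xs α⁺ (fold (∂ᶜ^-over ys α⁺ G) (∂xᶜ i) (lookup α⁺ i))
        ≡⟨ ≡.cong₂ (λ k r → ∂ᶜ^-over xs α⁺ (fold r (∂xᶜ i) k))
                   (lookup∘updateAt i α) (∂ᶜ^-over-updateAt α i suc ys≢i G) ⟩
      ∂ᶜ^-over xs α⁺ (∂xᶜ i (fold (∂ᶜ^-over ys α G) (∂xᶜ i) (lookup α i)))
        ≡⟨ ∂ᶜ^-over-updateAt α i suc xs≢i _ ⟩
      ∂ᶜ^-over xs α (∂xᶜ i (fold (∂ᶜ^-over ys α G) (∂xᶜ i) (lookup α i)))
        ≈⟨ ∂ᶜ^-over-comm {Q = λ _ → ⊤} (∂xᶜ-isLinear i) (λ {j} _ G → ∂xᶜ-comm j i G) α (All.universal _ xs) _ ⟩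
      ∂xᶜ i (∂ᶜ^-over xs α (fold (∂ᶜ^-over ys α G) (∂xᶜ i) (lookup α i)))
        ≡⟨ ≡.cong (∂xᶜ i) (∂ᶜ^-split α i allFin≡ G) ⟨
      ∂xᶜ i (∂ᶜ^ α G) ∎
    where
    α⁺ : Exp
    α⁺ = updateAt α i suc
    open ≋-Reasoning

  -- For m = 0 the junk value ℕ.pred 0 = 0 is harmless: it is multiplied by fromℕ K 0 = 0#.
  fold-∂xᶜ-mxᶜ : ∀ i m G → fold (mxᶜ i G) (∂xᶜ i) m
                           ≋ mxᶜ i (fold G (∂xᶜ i) m) ⊞ fromℕ K m ⋆ fold G (∂xᶜ i) (ℕ.pred m)
  fold-∂xᶜ-mxᶜ i zero    G α S = ≈-sym (≈-trans (+-congˡ (zeroˡ _)) (+-identityʳ _))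
  fold-∂xᶜ-mxᶜ i (suc m) G α S = begin
    ∂xᶜ i (fold (mxᶜ i G) (∂xᶜ i) m) α S
      ≈⟨ cong (∂xᶜ-isLinear i) (fold-∂xᶜ-mxᶜ i m G) α S ⟩
    ∂xᶜ i (mxᶜ i I ⊞ fromℕ K m ⋆ fold G (∂xᶜ i) (ℕ.pred m)) α S
      ≈⟨ ⊞-homo (∂xᶜ-isLinear i) (mxᶜ i I) (fromℕ K m ⋆ fold G (∂xᶜ i) (ℕ.pred m)) α S ⟩
    ∂xᶜ i (mxᶜ i I) α S + ∂xᶜ i (fromℕ K m ⋆ fold G (∂xᶜ i) (ℕ.pred m)) α S
      ≈⟨ +-cong (∂xᶜ-mxᶜ-leibniz i I α S)
                (≈-trans (⋆-homo (∂xᶜ-isLinear i) (fromℕ K m) (fold G (∂xᶜ i) (ℕ.pred m)) α S) (pred-junk m)) ⟩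
    (I α S + mxᶜ i (∂xᶜ i I) α S) + fromℕ K m * I α S
      ≈⟨ +-congʳ (+-comm _ _) ⟩
    (mxᶜ i (∂xᶜ i I) α S + I α S) + fromℕ K m * I α S
      ≈⟨ +-assoc _ _ _ ⟩
    mxᶜ i (∂xᶜ i I) α S + (I α S + fromℕ K m * I α S)
      ≈⟨ +-congˡ (≈-trans (distribʳ _ _ _) (+-congʳ (*-identityˡ _))) ⟨
    mxᶜ i (∂xᶜ i I) α S + (1# + fromℕ K m) * I α S ∎
    where
    I : Coeffs
    I = fold G (∂xᶜ i) m
    open SetoidReasoning setoid
    pred-junk : ∀ m → fromℕ K m * ∂xᶜ i (fold G (∂xᶜ i) (ℕ.pred m)) α S ≈ fromℕ K m * fold G (∂xᶜ i) m α S
    pred-junk zero    = ≈-trans (zeroˡ _) (≈-sym (zeroˡ _))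
    pred-junk (suc m) = ≈-refl

  ∂ᶜ^-mxᶜ : ∀ α i G → ∂ᶜ^ α (mxᶜ i G) ≋ mxᶜ i (∂ᶜ^ α G) ⊞ fromℕ K (lookup α i) ⋆ ∂ᶜ^ (updateAt α i ℕ.pred) G
  ∂ᶜ^-mxᶜ α i G with xs , ys , allFin≡ , xs≢i , ys≢i ← allFin-split i = begin
      ∂ᶜ^ α (mxᶜ i G)
        ≡⟨ ∂ᶜ^-split α i allFin≡ (mxᶜ i G) ⟩
      ∂xs (fold (∂ᶜ^-over ys α (mxᶜ i G)) (∂xᶜ i) m)
        ≈⟨ cong ∂xs-lin (cong (fold-isLinear m (∂xᶜ-isLinear i)) (∂ᶜ^-over-comm (mxᶜ-isLinear i) mx-comm α ys≢i G)) ⟩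
      ∂xs (fold (mxᶜ i Y) (∂xᶜ i) m)
        ≈⟨ cong ∂xs-lin (fold-∂xᶜ-mxᶜ i m Y) ⟩
      ∂xs (mxᶜ i (fold Y (∂xᶜ i) m) ⊞ fromℕ K m ⋆ fold Y (∂xᶜ i) (ℕ.pred m))
        ≈⟨ ⊞-homo ∂xs-lin _ _ ⟩
      ∂xs (mxᶜ i (fold Y (∂xᶜ i) m)) ⊞ ∂xs (fromℕ K m ⋆ fold Y (∂xᶜ i) (ℕ.pred m))
        ≈⟨ (λ β U → +-cong (∂ᶜ^-over-comm (mxᶜ-isLinear i) mx-comm α xs≢i _ β U) (⋆-homo ∂xs-lin _ _ β U)) ⟩
      mxᶜ i (∂xs (fold Y (∂xᶜ i) m)) ⊞ fromℕ K m ⋆ ∂xs (fold Y (∂xᶜ i) (ℕ.pred m))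
        ≡⟨ ≡.cong₂ (λ H H′ → mxᶜ i H ⊞ fromℕ K m ⋆ H′) (≡.sym (∂ᶜ^-split α i allFin≡ G)) lowered ⟩
      mxᶜ i (∂ᶜ^ α G) ⊞ fromℕ K m ⋆ ∂ᶜ^ α⁻ G ∎
    where
    open ≋-Reasoning
    m : ℕ
    m = lookup α i
    α⁻ : Exp
    α⁻ = updateAt α i ℕ.pred
    Y : Coeffs
    Y = ∂ᶜ^-over ys α G
    ∂xs : Endo
    ∂xs = ∂ᶜ^-over xs α
    ∂xs-lin : IsLinear ∂xs
    ∂xs-lin = ∂ᶜ^-over-isLinear xs α
    mx-comm : ∀ {j} → j ≢ i → ∀ G → ∂xᶜ j (mxᶜ i G) ≋ mxᶜ i (∂xᶜ j G)
    mx-comm j≢i = ∂xᶜ-mxᶜ-comm j≢i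
    lowered : ∂xs (fold Y (∂xᶜ i) (ℕ.pred m)) ≡ ∂ᶜ^ α⁻ G
    lowered = ≡.sym (≡.trans (∂ᶜ^-split α⁻ i allFin≡ G)
      (≡.trans (≡.cong₂ (λ k H → ∂ᶜ^-over xs α⁻ (fold H (∂xᶜ i) k))
                        (lookup∘updateAt i α) (∂ᶜ^-over-updateAt α i ℕ.pred ys≢i G))
               (∂ᶜ^-over-updateAt α i ℕ.pred xs≢i _)))

module PolynomialOperators {c ℓ : Level} (K : CommutativeRing c ℓ) (n : ℕ) where
  open CommutativeRing K hiding (zero) renaming (refl to ≈-refl; sym to ≈-sym; trans to ≈-trans)
  open Super K n
  open PartialDerivatives K n public

  θ-word : (Fin n → Endo) → Sub → Endo
  θ-word T S F = foldr T F (indices S)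

  -- opᶜ T p is p(∂ˣ₁, …, ∂ˣₙ, T₁, …, Tₙ) on coefficient functions; opˣ p ignores the
  -- θ-part of p and is only applied to p ∈ 𝕜[x].
  opᶜ : (Fin n → Endo) → Poly → Endo
  opᶜ T p F = ∑ p (λ (a , α , S) → a ⋆ ∂ᶜ^ α (θ-word T S F))

  opˣ : Poly → Endo
  opˣ p G = ∑ p (λ (a , α , _) → a ⋆ ∂ᶜ^ α G)

  θ-word-isLinear : ∀ {T} → (∀ i → IsLinear (T i)) → ∀ S → IsLinear (θ-word T S)
  θ-word-isLinear {T} t S = go (indices S)
    where
    go : ∀ is → IsLinear (λ F → foldr T F is)
    go []       = id-isLinear
    go (i ∷ is) = ∘-isLinear (t i) (go is)

  opᶜ-isLinear : ∀ {T} → (∀ i → IsLinear (T i)) → ∀ p → IsLinear (opᶜ T p)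
  opᶜ-isLinear t p = ∑-isLinear p λ (a , α , S) →
    ∘-isLinear (weight-isLinear λ _ _ → a) (∘-isLinear (∂ᶜ^-over-isLinear allFin α) (θ-word-isLinear t S))

  opˣ-isLinear : ∀ p → IsLinear (opˣ p)
  opˣ-isLinear p = ∑-isLinear p λ (a , α , _) → ∘-isLinear (weight-isLinear λ _ _ → a) (∂ᶜ^-over-isLinear allFin α)

  module _ {T : Fin n → Poly → Poly} {Tᶜ : Fin n → Endo} (tᶜ : ∀ i → IsLinear (Tᶜ i))
           (coeff-T : ∀ i r → coeff (T i r) ≋ Tᶜ i (coeff r)) where

    coeff-θ-word : ∀ is q → coeff (foldr T q is) ≋ foldr Tᶜ (coeff q) is
    coeff-θ-word []       q = ≋-refl
    coeff-θ-word (i ∷ is) q = ≋-trans (coeff-T i (foldr T q is)) (cong (tᶜ i) (coeff-θ-word is q))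

    coeff-substitute : ∀ p q → coeff (substitute ∂x T p q) ≋ opᶜ Tᶜ p (coeff q)
    coeff-substitute []                q = ≋-refl
    coeff-substitute ((a , α , S) ∷ p) q β U = begin
      coeff (substMono ∂x T a α S q ++ substitute ∂x T p q) β U
        ≈⟨ coeff-++ (substMono ∂x T a α S q) _ β U ⟩
      coeff (substMono ∂x T a α S q) β U + coeff (substitute ∂x T p q) β U
        ≈⟨ +-cong (coeff-scale a (foldr (λ i r → iter (lookup α i) (∂x i) r) (foldr T q (indices S)) allFin) β U)
                  (coeff-substitute p q β U) ⟩
      a * coeff (foldr (λ i r → iter (lookup α i) (∂x i) r) (foldr T q (indices S)) allFin) β U + opᶜ Tᶜ p (coeff q) β U
        ≈⟨ +-congʳ (*-congˡ (≋-trans (coeff-∂x-pow allFin α _)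
                                     (cong (∂ᶜ^-over-isLinear allFin α) (coeff-θ-word (indices S) q)) β U)) ⟩
      a * ∂ᶜ^ α (θ-word Tᶜ S (coeff q)) β U + opᶜ Tᶜ p (coeff q) β U ∎
      where open SetoidReasoning setoid

  coeff-· : ∀ p q → coeff (p · q) ≋ opᶜ ∂θᶜ p (coeff q)
  coeff-· = coeff-substitute ∂θᶜ-isLinear coeff-∂θ

  coeff-⊙ : ∀ p q → coeff (p ⊙ q) ≋ opᶜ mθᶜ p (coeff q)
  coeff-⊙ = coeff-substitute mθᶜ-isLinear coeff-mθ

  opᶜ-++ : ∀ T p q F → opᶜ T (p ++ q) F ≋ opᶜ T p F ⊞ opᶜ T q F
  opᶜ-++ T p q F = ∑-++ p q _

  opᶜ-scale : ∀ T x p F → opᶜ T (scale x p) F ≋ x ⋆ opᶜ T p F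
  opᶜ-scale T x []                F β U = ≈-sym (zeroʳ x)
  opᶜ-scale T x ((b , α , S) ∷ p) F β U =
    ≈-trans (+-cong (*-assoc _ _ _) (opᶜ-scale T x p F β U)) (≈-sym (distribˡ _ _ _))

  ∂x-∷ : ∀ i m p → ∂x i (m ∷ p) ≡ ∂x i (m ∷ []) ++ ∂x i p
  ∂x-∷ i (a , α , S) p with lookup α i
  ... | zero  = refl
  ... | suc k = refl

  opᶜ-∂x-monomial : ∀ T i a α S F →
    opᶜ T (∂x i ((a , α , S) ∷ [])) F ≋ a ⋆ (fromℕ K (lookup α i) ⋆ ∂ᶜ^ (updateAt α i ℕ.pred) (θ-word T S F))
  opᶜ-∂x-monomial T i a α S F β U with lookup α i in αᵢ≡
  ... | zero  = ≈-sym (≈-trans (*-congˡ (zeroˡ _)) (zeroʳ a))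
  ... | suc k = begin
    (a * fromℕ K (suc k)) * ∂ᶜ^ (α [ i ]≔ k) (θ-word T S F) β U + 0#
      ≈⟨ ≈-trans (+-identityʳ _) (*-assoc _ _ _) ⟩
    a * (fromℕ K (suc k) * ∂ᶜ^ (α [ i ]≔ k) (θ-word T S F) β U)
      ≡⟨ ≡.cong (λ α⁻ → a * (fromℕ K (suc k) * ∂ᶜ^ α⁻ (θ-word T S F) β U))
           (updateAt-cong-local i α (≡.cong ℕ.pred (≡.sym αᵢ≡))) ⟩
    a * (fromℕ K (suc k) * ∂ᶜ^ (updateAt α i ℕ.pred) (θ-word T S F) β U) ∎
    where open SetoidReasoning setoid

  module _ {T : Fin n → Endo} (t : ∀ j → IsLinear (T j)) {i} (T-mxᶜ : ∀ j G → mxᶜ i (T j G) ≋ T j (mxᶜ i G)) where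

    θ-word-mxᶜ : ∀ S F → θ-word T S (mxᶜ i F) ≋ mxᶜ i (θ-word T S F)
    θ-word-mxᶜ S F = go (indices S)
      where
      go : ∀ js → foldr T (mxᶜ i F) js ≋ mxᶜ i (foldr T F js)
      go []       = ≋-refl
      go (j ∷ js) = ≋-trans (cong (t j) (go js)) (≋-sym (T-mxᶜ j _))

    ⁅monomial,mxᶜ⁆ : ∀ a α S F → ⁅ (λ G → a ⋆ ∂ᶜ^ α (θ-word T S G)) , mxᶜ i ⁆ F
                                  ≋ a ⋆ (fromℕ K (lookup α i) ⋆ ∂ᶜ^ (updateAt α i ℕ.pred) (θ-word T S F))
    ⁅monomial,mxᶜ⁆ a α S F β U = begin
      a * ∂ᶜ^ α (θ-word T S (mxᶜ i F)) β U + - mxᶜ i (a ⋆ ∂ᶜ^ α W) β U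
        ≈⟨ +-cong (*-congˡ (cong (∂ᶜ^-over-isLinear allFin α) (θ-word-mxᶜ S F) β U))
                  (-‿cong (⋆-homo (mxᶜ-isLinear i) a (∂ᶜ^ α W) β U)) ⟩
      a * ∂ᶜ^ α (mxᶜ i W) β U + - (a * mxᶜ i (∂ᶜ^ α W) β U)
        ≈⟨ +-congʳ (*-congˡ (∂ᶜ^-mxᶜ α i W β U)) ⟩
      a * (mxᶜ i (∂ᶜ^ α W) β U + fromℕ K (lookup α i) * ∂ᶜ^ (updateAt α i ℕ.pred) W β U)
        + - (a * mxᶜ i (∂ᶜ^ α W) β U)
        ≈⟨ +-congʳ (distribˡ _ _ _) ⟩
      (a * mxᶜ i (∂ᶜ^ α W) β U + a * (fromℕ K (lookup α i) * ∂ᶜ^ (updateAt α i ℕ.pred) W β U))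
        + - (a * mxᶜ i (∂ᶜ^ α W) β U)
        ≈⟨ xyx⁻¹≈y _ _ ⟩
      a * (fromℕ K (lookup α i) * ∂ᶜ^ (updateAt α i ℕ.pred) W β U) ∎
      where
      W : Coeffs
      W = θ-word T S F
      open SetoidReasoning setoid
      open import Algebra.Properties.AbelianGroup +-abelianGroup using (xyx⁻¹≈y)

    opᶜ-∂x : ∀ P F → opᶜ T (∂x i P) F ≋ ⁅ opᶜ T P , mxᶜ i ⁆ F
    opᶜ-∂x []                F β U =
      ≈-sym (≈-trans (+-congˡ (≈-trans (-‿cong (0̂-homo (mxᶜ-isLinear i) β U)) -0#≈0#)) (+-identityʳ _))
      where open import Algebra.Properties.Ring ring using (-0#≈0#)
    opᶜ-∂x (m@(a , α , S) ∷ P) F = begin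
      opᶜ T (∂x i (m ∷ P)) F                  ≡⟨ ≡.cong (λ q → opᶜ T q F) (∂x-∷ i m P) ⟩
      opᶜ T (∂x i (m ∷ []) ++ ∂x i P) F       ≈⟨ opᶜ-++ T (∂x i (m ∷ [])) (∂x i P) F ⟩
      opᶜ T (∂x i (m ∷ [])) F ⊞ opᶜ T (∂x i P) F
        ≈⟨ (λ β U → +-cong (≋-trans (opᶜ-∂x-monomial T i a α S F) (≋-sym (⁅monomial,mxᶜ⁆ a α S F)) β U)
                           (opᶜ-∂x P F β U)) ⟩
      ⁅ (λ G → a ⋆ ∂ᶜ^ α (θ-word T S G)) , mxᶜ i ⁆ F ⊞ ⁅ opᶜ T P , mxᶜ i ⁆ F
        ≈⟨ ⁅⁆-distribʳ-⊞ (λ G → a ⋆ ∂ᶜ^ α (θ-word T S G)) (opᶜ T P) (mxᶜ-isLinear i) F ⟨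
      ⁅ opᶜ T (m ∷ P) , mxᶜ i ⁆ F             ∎
      where open ≋-Reasoning

  ∅ : Sub
  ∅ = replicate n false

  InPolyX : Poly → Set c
  InPolyX = All (λ (_ , _ , S) → S ≡ ∅)

  ι-InPolyX : ∀ f → InPolyX (ι f)
  ι-InPolyX []      = []
  ι-InPolyX (_ ∷ f) = refl ∷ ι-InPolyX f

  ∂x-InPolyX : ∀ i {P} → InPolyX P → InPolyX (∂x i P)
  ∂x-InPolyX i {[]}                []          = []
  ∂x-InPolyX i {m@(_ , α , _) ∷ P} (S≡∅ ∷ P∅) =
    ≡.subst InPolyX (≡.sym (∂x-∷ i m P)) (++⁺ (monomial S≡∅) (∂x-InPolyX i P∅))
    where
    monomial : ∀ {a S} → S ≡ ∅ → InPolyX (∂x i ((a , α , S) ∷ []))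
    monomial S≡∅ with lookup α i
    ... | zero  = []
    ... | suc _ = S≡∅ ∷ []

  ∇²-InPolyX : ∀ {P} → InPolyX P → InPolyX (∇² P)
  ∇²-InPolyX P∅ = concat⁺ (map⁺ (All.universal (λ i → ∂x-InPolyX i (∂x-InPolyX i P∅)) allFin))

  indices-∅ : ∀ {m} → indices (replicate m false) ≡ []
  indices-∅ {zero}  = refl
  indices-∅ {suc m} = ≡.cong (List.map suc) (indices-∅ {m})

  indices-∅[]≔true : ∀ {m} (i : Fin m) → indices (replicate m false [ i ]≔ true) ≡ i ∷ []
  indices-∅[]≔true {suc m} zero    = ≡.cong (λ is → zero ∷ List.map suc is) (indices-∅ {m})
  indices-∅[]≔true {suc m} (suc i) = ≡.cong (List.map suc) (indices-∅[]≔true i)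

  countBefore-∅ : ∀ {m} (i : Fin m) → countBefore i (replicate m false) ≡ 0
  countBefore-∅ zero    = refl
  countBefore-∅ (suc i) = countBefore-∅ i

  opᶜ-InPolyX : ∀ T {P} → InPolyX P → ∀ G → opᶜ T P G ≋ opˣ P G
  opᶜ-InPolyX T {[]}              []          G = ≋-refl
  opᶜ-InPolyX T {(a , α , _) ∷ P} (refl ∷ P∅) G β U =
    +-cong (reflexive (≡.cong (λ is → a * ∂ᶜ^ α (foldr T G is) β U) indices-∅)) (opᶜ-InPolyX T P∅ G β U)

  module _ (T : Fin n → Endo) where

    opᶜ-mx : ∀ i R F → opᶜ T (mx i R) F ≋ ∂xᶜ i (opᶜ T R F)
    opᶜ-mx i []                F = ≋-sym (0̂-homo (∂xᶜ-isLinear i))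
    opᶜ-mx i ((b , γ , V) ∷ R) F β U = begin
      (b * 1#) * ∂ᶜ^ (updateAt γ i suc) (θ-word T V F) β U + opᶜ T (mx i R) F β U
        ≈⟨ +-cong (≈-trans (*-congʳ (*-identityʳ b)) (*-congˡ (∂ᶜ^-updateAt-suc γ i (θ-word T V F) β U))) (opᶜ-mx i R F β U) ⟩
      b * ∂xᶜ i (∂ᶜ^ γ (θ-word T V F)) β U + ∂xᶜ i (opᶜ T R F) β U
        ≈⟨ +-congʳ (⋆-homo (∂xᶜ-isLinear i) b (∂ᶜ^ γ (θ-word T V F)) β U) ⟨
      ∂xᶜ i (b ⋆ ∂ᶜ^ γ (θ-word T V F)) β U + ∂xᶜ i (opᶜ T R F) β U
        ≈⟨ ⊞-homo (∂xᶜ-isLinear i) (b ⋆ ∂ᶜ^ γ (θ-word T V F)) (opᶜ T R F) β U ⟨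
      ∂xᶜ i (opᶜ T ((b , γ , V) ∷ R) F) β U ∎
      where open SetoidReasoning setoid

    opᶜ-mx-pow : ∀ α is Q F → opᶜ T (foldr (λ i r → iter (lookup α i) (mx i) r) Q is) F ≋ ∂ᶜ^-over is α (opᶜ T Q F)
    opᶜ-mx-pow α []       Q F = ≋-refl
    opᶜ-mx-pow α (i ∷ is) Q F = ≋-trans (iterate (lookup α i) _)
      (cong (fold-isLinear (lookup α i) (∂xᶜ-isLinear i)) (opᶜ-mx-pow α is Q F))
      where
      iterate : ∀ k R → opᶜ T (iter k (mx i) R) F ≋ fold (opᶜ T R F) (∂xᶜ i) k
      iterate zero    R = ≋-refl
      iterate (suc k) R = ≋-trans (opᶜ-mx i (iter k (mx i) R) F) (cong (∂xᶜ-isLinear i) (iterate k R))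

    opᶜ-⊛ : ∀ {P} → InPolyX P → ∀ Q F → opᶜ T (P ⊛ Q) F ≋ opˣ P (opᶜ T Q F)
    opᶜ-⊛ {[]}              []          Q F = ≋-refl
    opᶜ-⊛ {(a , α , _) ∷ P} (refl ∷ P∅) Q F = begin
      opᶜ T (scale a R ++ (P ⊛ Q)) F             ≈⟨ opᶜ-++ T (scale a R) (P ⊛ Q) F ⟩
      opᶜ T (scale a R) F ⊞ opᶜ T (P ⊛ Q) F      ≈⟨ (λ β U → +-cong (opᶜ-scale T a R F β U) (opᶜ-⊛ P∅ Q F β U)) ⟩
      a ⋆ opᶜ T R F ⊞ opˣ P (opᶜ T Q F)          ≈⟨ (λ β U → +-congʳ (*-congˡ (opᶜ-mx-pow α allFin _ F β U))) ⟩
      a ⋆ ∂ᶜ^ α (opᶜ T (foldr mθ Q (indices ∅)) F) ⊞ opˣ P (opᶜ T Q F)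
        ≡⟨ ≡.cong (λ is → a ⋆ ∂ᶜ^ α (opᶜ T (foldr mθ Q is) F) ⊞ opˣ P (opᶜ T Q F)) indices-∅ ⟩
      opˣ ((a , α , ∅) ∷ P) (opᶜ T Q F)          ∎
      where
      R : Poly
      R = foldr (λ i r → iter (lookup α i) (mx i) r) (foldr mθ Q (indices ∅)) allFin
      open ≋-Reasoning

    opᶜ-mθ : ∀ i {P} → InPolyX P → ∀ F → opᶜ T (mθ i P) F ≋ opˣ P (T i F)
    opᶜ-mθ i {[]}              []          F = ≋-refl
    opᶜ-mθ i {(a , α , _) ∷ P} (refl ∷ P∅) F β U
      rewrite lookup-replicate {n = n} i false | countBefore-∅ {n} i | indices-∅[]≔true i
      = +-cong (*-congʳ (*-identityʳ a)) (opᶜ-mθ i P∅ F β U)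

    opᶜ-d : ∀ f F → opᶜ T (d (ι f)) F ≋ ∑[ i ∈ allFin ] opˣ (∂x i (ι f)) (T i F)
    opᶜ-d f F = ≋-trans (∑-concatMap (λ i → mθ i (∂x i (ι f))) allFin _)
                        (∑-cong allFin λ i → opᶜ-mθ i (∂x-InPolyX i (ι-InPolyX f)) F)

  opˣ-comm : ∀ {M} → IsLinear M → (∀ j G → ∂xᶜ j (M G) ≋ M (∂xᶜ j G)) → ∀ P G → opˣ P (M G) ≋ M (opˣ P G)
  opˣ-comm {M} m comm P G = begin
    ∑ P (λ (a , α , _) → a ⋆ ∂ᶜ^ α (M G))   ≈⟨ ∑-cong P (λ (a , α , _) β U → *-congˡ (∂ᶜ^-comm m comm α G β U)) ⟩
    ∑ P (λ (a , α , _) → a ⋆ M (∂ᶜ^ α G))   ≈⟨ ∑-cong P (λ (a , α , _) → ≋-sym (⋆-homo m a (∂ᶜ^ α G))) ⟩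
    ∑ P (λ (a , α , _) → M (a ⋆ ∂ᶜ^ α G))   ≈⟨ ∑-homo m P _ ⟨
    M (opˣ P G)                              ∎
    where open ≋-Reasoning

  ∂xᶜ-opˣ-comm : ∀ j P G → ∂xᶜ j (opˣ P G) ≋ opˣ P (∂xᶜ j G)
  ∂xᶜ-opˣ-comm j P G = ≋-sym (opˣ-comm (∂xᶜ-isLinear j) (λ k G → ∂xᶜ-comm k j G) P G)

  opˣ-opˣ-comm : ∀ P Q G → opˣ P (opˣ Q G) ≋ opˣ Q (opˣ P G)
  opˣ-opˣ-comm P Q = opˣ-comm (opˣ-isLinear Q) (λ j G → ∂xᶜ-opˣ-comm j Q G) P

module CliffordRelations {c ℓ : Level} (K : CommutativeRing c ℓ) (n : ℕ) where
  open CommutativeRing K hiding (zero) renaming (refl to ≈-refl; sym to ≈-sym; trans to ≈-trans)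
  open Super K n
  open PolynomialOperators K n public

  ∂θᶜ-opˣ-comm : ∀ i P G → ∂θᶜ i (opˣ P G) ≋ opˣ P (∂θᶜ i G)
  ∂θᶜ-opˣ-comm i P G = ≋-sym (opˣ-comm (∂θᶜ-isLinear i) (λ j G → ∂xᶜ-∂θᶜ-comm j i G) P G)

  mθᶜ-opˣ-comm : ∀ i P G → mθᶜ i (opˣ P G) ≋ opˣ P (mθᶜ i G)
  mθᶜ-opˣ-comm i P G = ≋-sym (opˣ-comm (mθᶜ-isLinear i) (λ j G → ∂xᶜ-mθᶜ-comm j i G) P G)

  ∑∂θᶜ-∑mθᶜ-anticomm : ∀ (P Q : Fin n → Poly) H →
    (∑[ i ∈ allFin ] opˣ (P i) (∂θᶜ i (∑[ j ∈ allFin ] opˣ (Q j) (mθᶜ j H))))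
      ⊞ (∑[ j ∈ allFin ] opˣ (Q j) (mθᶜ j (∑[ i ∈ allFin ] opˣ (P i) (∂θᶜ i H))))
    ≋ ∑[ i ∈ allFin ] opˣ (P i) (opˣ (Q i) H)
  ∑∂θᶜ-∑mθᶜ-anticomm P Q H = begin
    (∑[ i ∈ allFin ] opˣ (P i) (∂θᶜ i (∑[ j ∈ allFin ] opˣ (Q j) (mθᶜ j H))))
      ⊞ (∑[ j ∈ allFin ] opˣ (Q j) (mθᶜ j (∑[ i ∈ allFin ] opˣ (P i) (∂θᶜ i H))))
      ≈⟨ (λ α S → +-cong (∂θᶜ-inside α S) (mθᶜ-inside α S)) ⟩
    (∑[ i ∈ allFin ] ∑[ j ∈ allFin ] PQ i j (∂θᶜ i (mθᶜ j H)))
      ⊞ (∑[ i ∈ allFin ] ∑[ j ∈ allFin ] PQ i j (mθᶜ j (∂θᶜ i H)))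
      ≈⟨ ∑-distrib-⊞ allFin _ _ ⟨
    ∑[ i ∈ allFin ] ((∑[ j ∈ allFin ] PQ i j (∂θᶜ i (mθᶜ j H))) ⊞ (∑[ j ∈ allFin ] PQ i j (mθᶜ j (∂θᶜ i H))))
      ≈⟨ ∑-cong allFin (λ i → ≋-sym (∑-distrib-⊞ allFin _ _)) ⟩
    ∑[ i ∈ allFin ] ∑[ j ∈ allFin ] (PQ i j (∂θᶜ i (mθᶜ j H)) ⊞ PQ i j (mθᶜ j (∂θᶜ i H)))
      ≈⟨ ∑-cong allFin (λ i → ∑-cong allFin (λ j → ≋-sym (⊞-homo (PQ-isLinear i j) _ _))) ⟩
    ∑[ i ∈ allFin ] ∑[ j ∈ allFin ] PQ i j (∂θᶜ i (mθᶜ j H) ⊞ mθᶜ j (∂θᶜ i H))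
      ≈⟨ ∑-cong allFin (λ i → ∑-single (allFin⁺ n) (∈-allFin i) λ j j≢i →
           ≋-trans (cong (PQ-isLinear i j) (∂θᶜ-mθᶜ-anticomm (j≢i ∘ ≡.sym) H)) (0̂-homo (PQ-isLinear i j))) ⟩
    ∑[ i ∈ allFin ] PQ i i (∂θᶜ i (mθᶜ i H) ⊞ mθᶜ i (∂θᶜ i H))
      ≈⟨ ∑-cong allFin (λ i → cong (PQ-isLinear i i) (∂θᶜ-mθᶜ-anticomm-self i H)) ⟩
    ∑[ i ∈ allFin ] PQ i i H ∎
    where
    open ≋-Reasoning
    PQ : Fin n → Fin n → Endo
    PQ i j = opˣ (P i) ∘ opˣ (Q j)
    PQ-isLinear : ∀ i j → IsLinear (PQ i j)
    PQ-isLinear i j = ∘-isLinear (opˣ-isLinear (P i)) (opˣ-isLinear (Q j))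
    ∂θᶜ-inside : ∑[ i ∈ allFin ] opˣ (P i) (∂θᶜ i (∑[ j ∈ allFin ] opˣ (Q j) (mθᶜ j H)))
                 ≋ ∑[ i ∈ allFin ] ∑[ j ∈ allFin ] PQ i j (∂θᶜ i (mθᶜ j H))
    ∂θᶜ-inside = ∑-cong allFin λ i → begin
      opˣ (P i) (∂θᶜ i (∑[ j ∈ allFin ] opˣ (Q j) (mθᶜ j H)))
        ≈⟨ cong (opˣ-isLinear (P i)) (∑-homo (∂θᶜ-isLinear i) allFin _) ⟩
      opˣ (P i) (∑[ j ∈ allFin ] ∂θᶜ i (opˣ (Q j) (mθᶜ j H)))
        ≈⟨ cong (opˣ-isLinear (P i)) (∑-cong allFin λ j → ∂θᶜ-opˣ-comm i (Q j) _) ⟩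
      opˣ (P i) (∑[ j ∈ allFin ] opˣ (Q j) (∂θᶜ i (mθᶜ j H)))
        ≈⟨ ∑-homo (opˣ-isLinear (P i)) allFin _ ⟩
      ∑[ j ∈ allFin ] PQ i j (∂θᶜ i (mθᶜ j H)) ∎
    mθᶜ-inside : ∑[ j ∈ allFin ] opˣ (Q j) (mθᶜ j (∑[ i ∈ allFin ] opˣ (P i) (∂θᶜ i H)))
                 ≋ ∑[ i ∈ allFin ] ∑[ j ∈ allFin ] PQ i j (mθᶜ j (∂θᶜ i H))
    mθᶜ-inside = ≋-trans (∑-cong allFin λ j → begin
      opˣ (Q j) (mθᶜ j (∑[ i ∈ allFin ] opˣ (P i) (∂θᶜ i H)))
        ≈⟨ cong (opˣ-isLinear (Q j)) (∑-homo (mθᶜ-isLinear j) allFin _) ⟩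
      opˣ (Q j) (∑[ i ∈ allFin ] mθᶜ j (opˣ (P i) (∂θᶜ i H)))
        ≈⟨ cong (opˣ-isLinear (Q j)) (∑-cong allFin λ i → mθᶜ-opˣ-comm j (P i) _) ⟩
      opˣ (Q j) (∑[ i ∈ allFin ] opˣ (P i) (mθᶜ j (∂θᶜ i H)))
        ≈⟨ ∑-homo (opˣ-isLinear (Q j)) allFin _ ⟩
      ∑[ i ∈ allFin ] opˣ (Q j) (opˣ (P i) (mθᶜ j (∂θᶜ i H)))
        ≈⟨ ∑-cong allFin (λ i → opˣ-opˣ-comm (Q j) (P i) _) ⟩
      ∑[ i ∈ allFin ] PQ i j (mθᶜ j (∂θᶜ i H)) ∎)
      (∑-comm allFin allFin _)

  Γ : Carrier → Poly → Poly → Poly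
  Γ half P Q = scale half (∇² (P ⊛ Q) ⊖ (∇² P ⊛ Q) ⊖ (P ⊛ ∇² Q))

  module _ {T : Fin n → Endo} (t : ∀ j → IsLinear (T j)) (T-mxᶜ : ∀ i j G → mxᶜ i (T j G) ≋ T j (mxᶜ i G)) where

    opᶜ-∇² : ∀ P F → opᶜ T (∇² P) F ≋ ∑[ i ∈ allFin ] ⁅ ⁅ opᶜ T P , mxᶜ i ⁆ , mxᶜ i ⁆ F
    opᶜ-∇² P F = ≋-trans (∑-concatMap (λ i → ∂x i (∂x i P)) allFin _) (∑-cong allFin λ i →
      ≋-trans (opᶜ-∂x t (T-mxᶜ i) (∂x i P) F) (⁅⁆-congˡ (mxᶜ-isLinear i) (opᶜ-∂x t (T-mxᶜ i) P) F))

    module _ {P} (P∅ : InPolyX P) (Q : Poly) (H : Coeffs) where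

      private
        Φ Ψ : Endo
        Φ = opᶜ T P
        Ψ = opᶜ T Q
        φ : IsLinear Φ
        φ = opᶜ-isLinear t P
        ⁅⁅_⁆⁆ : Endo → Fin n → Endo
        ⁅⁅ Θ ⁆⁆ i = ⁅ ⁅ Θ , mxᶜ i ⁆ , mxᶜ i ⁆

      opᶜ-⊛-InPolyX : ∀ Q X → opᶜ T (P ⊛ Q) X ≋ Φ (opᶜ T Q X)
      opᶜ-⊛-InPolyX Q X = ≋-trans (opᶜ-⊛ T P∅ Q X) (≋-sym (opᶜ-InPolyX T P∅ (opᶜ T Q X)))

      opᶜ-∇²[P⊛Q] : opᶜ T (∇² (P ⊛ Q)) H ≋
        ∑[ i ∈ allFin ] ((⁅⁅ Φ ⁆⁆ i (Ψ H) ⊞ ⁅ Φ , mxᶜ i ⁆ (⁅ Ψ , mxᶜ i ⁆ H))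
                          ⊞ (⁅ Φ , mxᶜ i ⁆ (⁅ Ψ , mxᶜ i ⁆ H) ⊞ Φ (⁅⁅ Ψ ⁆⁆ i H)))
      opᶜ-∇²[P⊛Q] = ≋-trans (opᶜ-∇² (P ⊛ Q) H) (∑-cong allFin λ i →
        ≋-trans (⁅⁆-congˡ (mxᶜ-isLinear i) (⁅⁆-congˡ (mxᶜ-isLinear i) (opᶜ-⊛-InPolyX Q)) H)
                (⁅⁅⁆⁆-leibniz Ψ φ (mxᶜ-isLinear i) H))

      opᶜ-[∇²P]⊛Q : opᶜ T (∇² P ⊛ Q) H ≋ ∑[ i ∈ allFin ] ⁅⁅ Φ ⁆⁆ i (Ψ H)
      opᶜ-[∇²P]⊛Q = ≋-trans (opᶜ-⊛ T (∇²-InPolyX P∅) Q H)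
        (≋-trans (≋-sym (opᶜ-InPolyX T (∇²-InPolyX P∅) (Ψ H))) (opᶜ-∇² P (Ψ H)))

      opᶜ-P⊛[∇²Q] : opᶜ T (P ⊛ ∇² Q) H ≋ ∑[ i ∈ allFin ] Φ (⁅⁅ Ψ ⁆⁆ i H)
      opᶜ-P⊛[∇²Q] = ≋-trans (opᶜ-⊛-InPolyX (∇² Q) H) (≋-trans (cong φ (opᶜ-∇² Q H)) (∑-homo φ allFin _))

      ∑opˣ∂x∘opᶜ∂x-as-⁅⁆ : ∑[ i ∈ allFin ] opˣ (∂x i P) (opᶜ T (∂x i Q) H)
                           ≋ ∑[ i ∈ allFin ] ⁅ Φ , mxᶜ i ⁆ (⁅ Ψ , mxᶜ i ⁆ H)
      ∑opˣ∂x∘opᶜ∂x-as-⁅⁆ = ∑-cong allFin λ i → ≋-trans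
        (≋-sym (opᶜ-InPolyX T (∂x-InPolyX i P∅) (opᶜ T (∂x i Q) H)))
        (≋-trans (opᶜ-∂x t (T-mxᶜ i) P (opᶜ T (∂x i Q) H))
                 (cong (⁅⁆-isLinear φ (mxᶜ-isLinear i)) (opᶜ-∂x t (T-mxᶜ i) Q H)))

      opᶜ-∇²-polarisation : ∀ half → half + half ≈ 1# →
        opᶜ T (Γ half P Q) H ≋ ∑[ i ∈ allFin ] opˣ (∂x i P) (opᶜ T (∂x i Q) H)
      opᶜ-∇²-polarisation half half+half≈1 α S = begin
        opᶜ T (scale half ((A ++ scale (- 1#) B) ++ scale (- 1#) C)) H α S
          ≈⟨ opᶜ-scale T half ((A ++ scale (- 1#) B) ++ scale (- 1#) C) H α S ⟩
        half * opᶜ T ((A ++ scale (- 1#) B) ++ scale (- 1#) C) H α S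
          ≈⟨ *-congˡ (≈-trans (opᶜ-++ T (A ++ scale (- 1#) B) (scale (- 1#) C) H α S)
               (+-cong (≈-trans (opᶜ-++ T A (scale (- 1#) B) H α S) (+-congˡ (opᶜ-scale T (- 1#) B H α S)))
                       (opᶜ-scale T (- 1#) C H α S))) ⟩
        half * ((opᶜ T A H α S + - 1# * opᶜ T B H α S) + - 1# * opᶜ T C H α S)
          ≈⟨ *-congˡ (+-cong (+-cong (≈-trans (opᶜ-∇²[P⊛Q] α S) split) (*-congˡ (opᶜ-[∇²P]⊛Q α S)))
                             (*-congˡ (opᶜ-P⊛[∇²Q] α S))) ⟩
        half * ((((∑ allFin outer α S + ∑ allFin mixed α S) + (∑ allFin mixed α S + ∑ allFin inner α S))
                 + - 1# * ∑ allFin outer α S) + - 1# * ∑ allFin inner α S)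
          ≈⟨ half-cancel _ _ _ ⟩
        ∑ allFin mixed α S
          ≈⟨ ∑opˣ∂x∘opᶜ∂x-as-⁅⁆ α S ⟨
        (∑[ i ∈ allFin ] opˣ (∂x i P) (opᶜ T (∂x i Q) H)) α S ∎
        where
        open SetoidReasoning setoid
        open import Algebra.Properties.Ring ring using (-1*x≈-x)
        open import Algebra.Properties.AbelianGroup +-abelianGroup using (xyx⁻¹≈y)
        A B C : Poly
        A = ∇² (P ⊛ Q)
        B = ∇² P ⊛ Q
        C = P ⊛ ∇² Q
        outer mixed inner : Fin n → Coeffs
        outer i = ⁅⁅ Φ ⁆⁆ i (Ψ H)
        mixed i = ⁅ Φ , mxᶜ i ⁆ (⁅ Ψ , mxᶜ i ⁆ H)
        inner i = Φ (⁅⁅ Ψ ⁆⁆ i H)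
        split : (∑[ i ∈ allFin ] ((outer i ⊞ mixed i) ⊞ (mixed i ⊞ inner i))) α S
                ≈ (∑ allFin outer α S + ∑ allFin mixed α S) + (∑ allFin mixed α S + ∑ allFin inner α S)
        split = ≈-trans (∑-distrib-⊞ allFin _ _ α S)
                        (+-cong (∑-distrib-⊞ allFin outer mixed α S) (∑-distrib-⊞ allFin mixed inner α S))
        half-cancel : ∀ x y z → half * ((((x + y) + (y + z)) + - 1# * x) + - 1# * z) ≈ y
        half-cancel x y z = begin
          half * ((((x + y) + (y + z)) + - 1# * x) + - 1# * z)
            ≈⟨ *-congˡ (+-cong (+-cong (+-assoc _ _ _) (-1*x≈-x x)) (-1*x≈-x z)) ⟩
          half * (((x + (y + (y + z))) + - x) + - z) ≈⟨ *-congˡ (+-congʳ (xyx⁻¹≈y x _)) ⟩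
          half * ((y + (y + z)) + - z)                ≈⟨ *-congˡ (≈-trans (+-congʳ (≈-sym (+-assoc _ _ _))) (+-‿-cancelʳ _ _)) ⟩
          half * (y + y)                              ≈⟨ distribˡ _ _ _ ⟩
          half * y + half * y                         ≈⟨ distribʳ _ _ _ ⟨
          (half + half) * y                           ≈⟨ *-congʳ half+half≈1 ⟩
          1# * y                                      ≈⟨ *-identityˡ y ⟩
          y                                           ∎
          where
          +-‿-cancelʳ : ∀ u v → (u + v) + - v ≈ u
          +-‿-cancelʳ u v = ≈-trans (+-assoc _ _ _) (≈-trans (+-congˡ (-‿inverseʳ v)) (+-identityʳ u))

module DifferentialActions {c ℓ : Level} (K : CommutativeRing c ℓ) (n : ℕ) where
  open CommutativeRing K hiding (zero) renaming (refl to ≈-refl; sym to ≈-sym; trans to ≈-trans)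
  open Super K n
  open CliffordRelations K n public

  coeff-d· : ∀ f q → coeff (d (ι f) · q) ≋ ∑[ i ∈ allFin ] opˣ (∂x i (ι f)) (∂θᶜ i (coeff q))
  coeff-d· f q = ≋-trans (coeff-· (d (ι f)) q) (opᶜ-d ∂θᶜ f (coeff q))

  coeff-d⊙ : ∀ f q → coeff (d (ι f) ⊙ q) ≋ ∑[ i ∈ allFin ] opˣ (∂x i (ι f)) (mθᶜ i (coeff q))
  coeff-d⊙ f q = ≋-trans (coeff-⊙ (d (ι f)) q) (opᶜ-d mθᶜ f (coeff q))

  coeff-d·d⊙ : ∀ f g h → coeff (d (ι f) · (d (ι g) ⊙ h))
    ≋ ∑[ i ∈ allFin ] opˣ (∂x i (ι f)) (∂θᶜ i (∑[ j ∈ allFin ] opˣ (∂x j (ι g)) (mθᶜ j (coeff h))))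
  coeff-d·d⊙ f g h = ≋-trans (coeff-d· f (d (ι g) ⊙ h))
    (∑-cong allFin λ i → cong (opˣ-isLinear (∂x i (ι f))) (cong (∂θᶜ-isLinear i) (coeff-d⊙ g h)))

  coeff-d⊙d· : ∀ f g h → coeff (d (ι g) ⊙ (d (ι f) · h))
    ≋ ∑[ j ∈ allFin ] opˣ (∂x j (ι g)) (mθᶜ j (∑[ i ∈ allFin ] opˣ (∂x i (ι f)) (∂θᶜ i (coeff h))))
  coeff-d⊙d· f g h = ≋-trans (coeff-d⊙ g (d (ι f) · h))
    (∑-cong allFin λ j → cong (opˣ-isLinear (∂x j (ι g))) (cong (mθᶜ-isLinear j) (coeff-d· f h)))

  coeff-∇²-polarisation : ∀ half → half + half ≈ 1# → ∀ f g h →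
    coeff (Γ half (ι f) (ι g) · h)
      ≋ ∑[ i ∈ allFin ] opˣ (∂x i (ι f)) (opˣ (∂x i (ι g)) (coeff h))
  coeff-∇²-polarisation half half+half≈1 f g h = ≋-trans (coeff-· (Γ half (ι f) (ι g)) h)
    (≋-trans (opᶜ-∇²-polarisation ∂θᶜ-isLinear mxᶜ-∂θᶜ-comm (ι-InPolyX f) (ι g) (coeff h) half half+half≈1)
      (∑-cong allFin λ i → cong (opˣ-isLinear (∂x i (ι f))) (opᶜ-InPolyX ∂θᶜ (∂x-InPolyX i (ι-InPolyX g)) (coeff h))))


lemma7p3 : {c ℓ : Level} (K : CommutativeRing c ℓ) → IsCharZeroField K →
    (half : CommutativeRing.Carrier K) →
    CommutativeRing._≈_ K (CommutativeRing._+_ K half half) (CommutativeRing.1# K) →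
    (n : ℕ) → let open Super K n in
    (f g : PolyX) (h : Poly) →
      d (ι f) · (d (ι g) ⊙ h)
        ≈P (⊝ (d (ι g) ⊙ (d (ι f) · h)))
           ⊕ (scale half (∇² (ι f ⊛ ι g) ⊖ (∇² (ι f) ⊛ ι g) ⊖ (ι f ⊛ ∇² (ι g)))) · h
lemma7p3 K _ half half+half≈1 n f g h α S = begin
  coeff (d (ι f) · (d (ι g) ⊙ h)) α S
    ≈⟨ coeff-d·d⊙ f g h α S ⟩
  (∑[ i ∈ allFin ] opˣ (∂f i) (∂θᶜ i (∑[ j ∈ allFin ] opˣ (∂g j) (mθᶜ j H)))) α S
    ≈⟨ x+y≈z⇒x≈-y+z (∑∂θᶜ-∑mθᶜ-anticomm ∂f ∂g H α S) ⟩
  - (∑[ j ∈ allFin ] opˣ (∂g j) (mθᶜ j (∑[ i ∈ allFin ] opˣ (∂f i) (∂θᶜ i H)))) α S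
    + (∑[ i ∈ allFin ] opˣ (∂f i) (opˣ (∂g i) H)) α S
    ≈⟨ +-cong (-‿cong (coeff-d⊙d· f g h α S)) (coeff-∇²-polarisation half half+half≈1 f g h α S) ⟨
  - coeff (d (ι g) ⊙ (d (ι f) · h)) α S + coeff (Γ half (ι f) (ι g) · h) α S
    ≈⟨ coeff-⊝⊕ (d (ι g) ⊙ (d (ι f) · h)) (Γ half (ι f) (ι g) · h) α S ⟨
  coeff (⊝ (d (ι g) ⊙ (d (ι f) · h)) ⊕ Γ half (ι f) (ι g) · h) α S ∎
  where
  open CommutativeRing K
  open Super K n
  open DifferentialActions K n
  open SetoidReasoning setoid
  ∂f ∂g : Fin n → Poly
  ∂f i = ∂x i (ι f)
  ∂g i = ∂x i (ι g)
  H : Coeffs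
  H = coeff h
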